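{- Work constructively (IZF). Let $A$ be a $\Sigma$-structure and $\mathbb{T}$ a theory over $\Sigma$. Suppose $\psi(\vec{x})$ and $\varphi(\vec{x},\vec{y})$ are (arbitrary first-order) formulas over $\Sigma$, and $\vec{a}$ is a tuple of elements of $A$ indexed by $\vec{y}$, such that $\varphi(\vec{x},\vec{a}) \vdash^{\mathbb{T} \cup \mathrm{Diag}(A)}_{\vec{x}} \psi(\vec{x})$. Then there is some regular formula $\chi(\vec{y})$ over $\Sigma$ such that $\top \vdash^{\mathrm{Diag}(A)} \chi(\vec{a})$ (equivalently, $A \models \chi(\vec{a})$), and $\chi(\vec{y}) \wedge \varphi(\vec{x},\vec{y}) \vdash^{\mathbb{T}}_{\vec{x},\vec{y}} \psi(\vec{x})$.
   Context: Signatures are arbitrary, not assumed discrete. A regular formula is built from atomic formulas (including equalities), $\top$, $\wedge$ and $\exists$. For a $\Sigma$-structure $A$, $\Sigma+|A|$ adds a new constant for each element of $A$; $\mathrm{Diag}(A)$ is the theory over $\Sigma+|A|$ consisting of the sequents $\top\vdash\sigma$ for each atomic sentence $\sigma$ of the form $\theta(\vec b)$, $\theta$ atomic over $\Sigma$, $\vec b$ elements of $A$, such that $A\models\theta(\vec b)$. Derivability $\vdash^{\mathbb{T}}$ is in intuitionistic first-order sequent calculus from the axioms of $\mathbb{T}$. -}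

module Defs where

open import Data.List using (List; []; _∷_; _++_)
open import Data.Product using (Σ; _,_; _×_)
open import Data.Sum using (_⊎_; inj₁; inj₂; [_,_])
open import Relation.Binary.PropositionalEquality using (_≡_)

-- Signatures (arbitrary: no decidability assumptions on symbols)

record Signature : Set₁ where
  field
    Sort : Set
    Fun  : Set
    Rel  : Set
    dom  : Fun → List Sort
    cod  : Fun → Sort
    rdom : Rel → List Sort

open Signature public

data Var {X : Set} : List X → X → Set where
  vz : ∀ {Γ σ} → Var (σ ∷ Γ) σ
  vs : ∀ {Γ σ τ} → Var Γ σ → Var (τ ∷ Γ) σ

Ren : {X : Set} → List X → List X → Set
Ren Γ Δ = ∀ {σ} → Var Γ σ → Var Δ σ

liftR : {X : Set} {Γ Δ : List X} {τ : X} → Ren Γ Δ → Ren (τ ∷ Γ) (τ ∷ Δ)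
liftR r vz     = vz
liftR r (vs v) = vs (r v)

-- the context x⃗ ++ y⃗ and its two inclusions / case split
injL : {X : Set} {Γ Δ : List X} → Ren Γ (Γ ++ Δ)
injL vz     = vz
injL (vs v) = vs (injL v)

injR : {X : Set} (Γ : List X) {Δ : List X} → Ren Δ (Γ ++ Δ)
injR []      v = v
injR (τ ∷ Γ) v = vs (injR Γ v)

splitVar : {X : Set} (Γ : List X) {Δ : List X} {σ : X} →
           Var (Γ ++ Δ) σ → Var Γ σ ⊎ Var Δ σ
splitVar []      v      = inj₂ v
splitVar (τ ∷ Γ) vz     = inj₁ vz
splitVar (τ ∷ Γ) (vs v) with splitVar Γ v
... | inj₁ w = inj₁ (vs w)
... | inj₂ w = inj₂ w

module _ (S : Signature) where

  Ctx : Set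
  Ctx = List (Sort S)

  mutual
    data Term (Γ : Ctx) : Sort S → Set where
      var : ∀ {σ} → Var Γ σ → Term Γ σ
      app : (f : Fun S) → Terms Γ (dom S f) → Term Γ (cod S f)

    data Terms (Γ : Ctx) : List (Sort S) → Set where
      []  : Terms Γ []
      _∷_ : ∀ {σ σs} → Term Γ σ → Terms Γ σs → Terms Γ (σ ∷ σs)

  data Atomic (Γ : Ctx) : Set where
    rel : (R : Rel S) → Terms Γ (rdom S R) → Atomic Γ
    _≐_ : ∀ {σ} → Term Γ σ → Term Γ σ → Atomic Γ

  data Formula (Γ : Ctx) : Set where
    atom  : Atomic Γ → Formula Γ
    ⊤ᶠ ⊥ᶠ : Formula Γ
    _∧ᶠ_ _∨ᶠ_ _⇒ᶠ_ : Formula Γ → Formula Γ → Formula Γ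
    ∃ᶠ ∀ᶠ : (τ : Sort S) → Formula (τ ∷ Γ) → Formula Γ

  infixr 6 _∧ᶠ_
  infixr 5 _∨ᶠ_
  infixr 4 _⇒ᶠ_

  data IsRegular {Γ : Ctx} : Formula Γ → Set where
    reg-atom : (θ : Atomic Γ) → IsRegular (atom θ)
    reg-⊤    : IsRegular ⊤ᶠ
    reg-∧    : ∀ {φ ψ} → IsRegular φ → IsRegular ψ → IsRegular (φ ∧ᶠ ψ)
    reg-∃    : ∀ {τ φ} → IsRegular {τ ∷ Γ} φ → IsRegular (∃ᶠ τ φ)

  mutual
    renTerm : ∀ {Γ Δ σ} → Ren Γ Δ → Term Γ σ → Term Δ σ
    renTerm r (var v)    = var (r v)
    renTerm r (app f ts) = app f (renTerms r ts)

    renTerms : ∀ {Γ Δ σs} → Ren Γ Δ → Terms Γ σs → Terms Δ σs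
    renTerms r []       = []
    renTerms r (t ∷ ts) = renTerm r t ∷ renTerms r ts

  renAtom : ∀ {Γ Δ} → Ren Γ Δ → Atomic Γ → Atomic Δ
  renAtom r (rel R ts) = rel R (renTerms r ts)
  renAtom r (t ≐ u)    = renTerm r t ≐ renTerm r u

  renForm : ∀ {Γ Δ} → Ren Γ Δ → Formula Γ → Formula Δ
  renForm r (atom θ)  = atom (renAtom r θ)
  renForm r ⊤ᶠ        = ⊤ᶠ
  renForm r ⊥ᶠ        = ⊥ᶠ
  renForm r (φ ∧ᶠ ψ)  = renForm r φ ∧ᶠ renForm r ψ
  renForm r (φ ∨ᶠ ψ)  = renForm r φ ∨ᶠ renForm r ψ
  renForm r (φ ⇒ᶠ ψ)  = renForm r φ ⇒ᶠ renForm r ψ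
  renForm r (∃ᶠ τ φ)  = ∃ᶠ τ (renForm (liftR r) φ)
  renForm r (∀ᶠ τ φ)  = ∀ᶠ τ (renForm (liftR r) φ)

  Sub : Ctx → Ctx → Set
  Sub Γ Δ = ∀ {σ} → Var Γ σ → Term Δ σ

  liftS : ∀ {Γ Δ τ} → Sub Γ Δ → Sub (τ ∷ Γ) (τ ∷ Δ)
  liftS s vz     = var vz
  liftS s (vs v) = renTerm vs (s v)

  mutual
    subTerm : ∀ {Γ Δ σ} → Sub Γ Δ → Term Γ σ → Term Δ σ
    subTerm s (var v)    = s v
    subTerm s (app f ts) = app f (subTerms s ts)

    subTerms : ∀ {Γ Δ σs} → Sub Γ Δ → Terms Γ σs → Terms Δ σs
    subTerms s []       = []
    subTerms s (t ∷ ts) = subTerm s t ∷ subTerms s ts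

  subAtom : ∀ {Γ Δ} → Sub Γ Δ → Atomic Γ → Atomic Δ
  subAtom s (rel R ts) = rel R (subTerms s ts)
  subAtom s (t ≐ u)    = subTerm s t ≐ subTerm s u

  subForm : ∀ {Γ Δ} → Sub Γ Δ → Formula Γ → Formula Δ
  subForm s (atom θ)  = atom (subAtom s θ)
  subForm s ⊤ᶠ        = ⊤ᶠ
  subForm s ⊥ᶠ        = ⊥ᶠ
  subForm s (φ ∧ᶠ ψ)  = subForm s φ ∧ᶠ subForm s ψ
  subForm s (φ ∨ᶠ ψ)  = subForm s φ ∨ᶠ subForm s ψ
  subForm s (φ ⇒ᶠ ψ)  = subForm s φ ⇒ᶠ subForm s ψ
  subForm s (∃ᶠ τ φ)  = ∃ᶠ τ (subForm (liftS s) φ)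
  subForm s (∀ᶠ τ φ)  = ∀ᶠ τ (subForm (liftS s) φ)

  record Theory : Set₁ where
    field
      Ax  : Set
      ctx : Ax → Ctx
      pre post : (i : Ax) → Formula (ctx i)

  open Theory public

  eqR₀ : ∀ {Γ : Ctx} {τ : Sort S} → Ren (τ ∷ Γ) (τ ∷ τ ∷ Γ)
  eqR₀ vz     = vs vz
  eqR₀ (vs v) = vs (vs v)

  eqR₁ : ∀ {Γ : Ctx} {τ : Sort S} → Ren (τ ∷ Γ) (τ ∷ τ ∷ Γ)
  eqR₁ vz     = vz
  eqR₁ (vs v) = vs (vs v)

  -- derivability φ ⊢^T_Γ ψ in the intuitionistic first-order sequent
  -- calculus (Johnstone, Elephant D1.3.1) with the axioms of T
  data Der (T : Theory) : (Γ : Ctx) → Formula Γ → Formula Γ → Set where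
    axiom : (i : Ax T) → Der T (ctx T i) (pre T i) (post T i)
    ident : ∀ {Γ φ} → Der T Γ φ φ
    subst : ∀ {Γ Δ φ ψ} (s : Sub Γ Δ) → Der T Γ φ ψ →
            Der T Δ (subForm s φ) (subForm s ψ)
    cut   : ∀ {Γ φ ψ χ} → Der T Γ φ ψ → Der T Γ ψ χ → Der T Γ φ χ
    eq-refl  : ∀ {Γ τ} → Der T (τ ∷ Γ) ⊤ᶠ (atom (var vz ≐ var vz))
    eq-subst : ∀ {Γ τ} (φ : Formula (τ ∷ Γ)) →
               Der T (τ ∷ τ ∷ Γ)
                 (atom (var (vs vz) ≐ var vz) ∧ᶠ renForm eqR₀ φ)
                 (renForm eqR₁ φ)
    ⊤-intro : ∀ {Γ φ} → Der T Γ φ ⊤ᶠ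
    ∧-elim₁ : ∀ {Γ φ ψ} → Der T Γ (φ ∧ᶠ ψ) φ
    ∧-elim₂ : ∀ {Γ φ ψ} → Der T Γ (φ ∧ᶠ ψ) ψ
    ∧-intro : ∀ {Γ φ ψ χ} → Der T Γ φ ψ → Der T Γ φ χ → Der T Γ φ (ψ ∧ᶠ χ)
    ⊥-elim  : ∀ {Γ φ} → Der T Γ ⊥ᶠ φ
    ∨-intro₁ : ∀ {Γ φ ψ} → Der T Γ φ (φ ∨ᶠ ψ)
    ∨-intro₂ : ∀ {Γ φ ψ} → Der T Γ ψ (φ ∨ᶠ ψ)
    ∨-elim  : ∀ {Γ φ ψ χ} → Der T Γ φ χ → Der T Γ ψ χ → Der T Γ (φ ∨ᶠ ψ) χ
    -- implication (both directions of the double-line rule)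
    ⇒-intro : ∀ {Γ φ ψ χ} → Der T Γ (φ ∧ᶠ ψ) χ → Der T Γ ψ (φ ⇒ᶠ χ)
    ⇒-elim  : ∀ {Γ φ ψ χ} → Der T Γ ψ (φ ⇒ᶠ χ) → Der T Γ (φ ∧ᶠ ψ) χ
    ∃-left  : ∀ {Γ : Ctx} {τ φ ψ} → Der T (τ ∷ Γ) φ (renForm (vs {τ = τ}) ψ) → Der T Γ (∃ᶠ τ φ) ψ
    ∃-left⁻ : ∀ {Γ : Ctx} {τ φ ψ} → Der T Γ (∃ᶠ τ φ) ψ → Der T (τ ∷ Γ) φ (renForm (vs {τ = τ}) ψ)
    ∀-right  : ∀ {Γ : Ctx} {τ φ ψ} → Der T (τ ∷ Γ) (renForm (vs {τ = τ}) φ) ψ → Der T Γ φ (∀ᶠ τ ψ)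
    ∀-right⁻ : ∀ {Γ : Ctx} {τ φ ψ} → Der T Γ φ (∀ᶠ τ ψ) → Der T (τ ∷ Γ) (renForm (vs {τ = τ}) φ) ψ

_∪_ : {S : Signature} → Theory S → Theory S → Theory S
Ax   (T ∪ U) = Ax T ⊎ Ax U
ctx  (T ∪ U) = [ ctx T , ctx U ]
pre  (T ∪ U) (inj₁ i) = pre T i
pre  (T ∪ U) (inj₂ j) = pre U j
post (T ∪ U) (inj₁ i) = post T i
post (T ∪ U) (inj₂ j) = post U j


record Structure (S : Signature) : Set₁ where
  field
    Carrier : Sort S → Set
    funI : (f : Fun S) → (∀ {σ} → Var (dom S f) σ → Carrier σ) → Carrier (cod S f)
    relI : (R : Rel S) → (∀ {σ} → Var (rdom S R) σ → Carrier σ) → Set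

open Structure public

Env : {S : Signature} → Structure S → Ctx S → Set
Env A Γ = ∀ {σ} → Var Γ σ → Carrier A σ

module _ {S : Signature} (A : Structure S) where

  mutual
    eval : ∀ {Γ σ} → Term S Γ σ → Env A Γ → Carrier A σ
    eval (var v)    ρ = ρ v
    eval (app f ts) ρ = funI A f (evalTerms ts ρ)

    evalTerms : ∀ {Γ σs} → Terms S Γ σs → Env A Γ → Env A σs
    evalTerms (t ∷ ts) ρ vz     = eval t ρ
    evalTerms (t ∷ ts) ρ (vs v) = evalTerms ts ρ v

  SatAtomic : ∀ {Γ} → Atomic S Γ → Env A Γ → Set
  SatAtomic (rel R ts) ρ = relI A R (evalTerms ts ρ)
  SatAtomic (t ≐ u)    ρ = eval t ρ ≡ eval u ρ

module _ (S : Signature) (A : Structure S) where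

  extend : Signature
  Sort extend = Sort S
  Fun  extend = Fun S ⊎ Σ (Sort S) (Carrier A)
  Rel  extend = Rel S
  dom  extend (inj₁ f) = dom S f
  dom  extend (inj₂ _) = []
  cod  extend (inj₁ f) = cod S f
  cod  extend (inj₂ (σ , _)) = σ
  rdom extend R = rdom S R

module _ {S : Signature} {A : Structure S} where

  const : ∀ {Γ σ} → Carrier A σ → Term (extend S A) Γ σ
  const {σ = σ} b = app (inj₂ (σ , b)) []

  mutual
    trTerm : ∀ {Γ σ} → Term S Γ σ → Term (extend S A) Γ σ
    trTerm (var v)    = var v
    trTerm (app f ts) = app (inj₁ f) (trTerms ts)

    trTerms : ∀ {Γ σs} → Terms S Γ σs → Terms (extend S A) Γ σs
    trTerms []       = []
    trTerms (t ∷ ts) = trTerm t ∷ trTerms ts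

  trAtom : ∀ {Γ} → Atomic S Γ → Atomic (extend S A) Γ
  trAtom (rel R ts) = rel R (trTerms ts)
  trAtom (t ≐ u)    = trTerm t ≐ trTerm u

  trForm : ∀ {Γ} → Formula S Γ → Formula (extend S A) Γ
  trForm (atom θ)  = atom (trAtom θ)
  trForm ⊤ᶠ        = ⊤ᶠ
  trForm ⊥ᶠ        = ⊥ᶠ
  trForm (φ ∧ᶠ ψ)  = trForm φ ∧ᶠ trForm ψ
  trForm (φ ∨ᶠ ψ)  = trForm φ ∨ᶠ trForm ψ
  trForm (φ ⇒ᶠ ψ)  = trForm φ ⇒ᶠ trForm ψ
  trForm (∃ᶠ τ φ)  = ∃ᶠ τ (trForm φ)
  trForm (∀ᶠ τ φ)  = ∀ᶠ τ (trForm φ)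

  names : ∀ {Γ} → Env A Γ → Sub (extend S A) Γ []
  names ρ v = const (ρ v)

  instantiate : ∀ {Δ} → Formula S Δ → Env A Δ → Formula (extend S A) []
  instantiate χ a = subForm (extend S A) (names a) (trForm χ)

  plugSub : ∀ (Γ : Ctx S) {Δ} → Env A Δ → Sub (extend S A) (Γ ++ Δ) Γ
  plugSub Γ a v = [ var , (λ w → const (a w)) ] (splitVar Γ v)

  plug : ∀ (Γ : Ctx S) {Δ} → Formula S (Γ ++ Δ) → Env A Δ → Formula (extend S A) Γ
  plug Γ φ a = subForm (extend S A) (plugSub Γ a) (trForm φ)

  trTheory : Theory S → Theory (extend S A)
  Ax   (trTheory T) = Ax T
  ctx  (trTheory T) = ctx T
  pre  (trTheory T) i = trForm (pre T i)
  post (trTheory T) i = trForm (post T i)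

Diag : {S : Signature} (A : Structure S) → Theory (extend S A)
Ax   (Diag {S} A) = Σ (Ctx S) λ Γ → Σ (Atomic S Γ) λ θ → Σ (Env A Γ) λ b → SatAtomic A θ b
ctx  (Diag A) _ = []
pre  (Diag A) _ = ⊤ᶠ
post (Diag {S} A) (Γ , θ , b , _) = atom (subAtom (extend S A) (names b) (trAtom θ))

-- Replace every constant b of Σ+|A| by a fresh parameter variable whose value
-- in A is b.  A derivation of φ(x⃗, a⃗) ⊢ ψ(x⃗) from T ∪ Diag(A) is then reflected,
-- rule by rule, into a derivation in T of the abstracted sequent under a guard:
-- a regular formula in the parameters that holds of their values.  Axioms of
-- Diag(A) become their own guards; two abstractions of the same formula are
-- interderivable under the true equations between their parameters; and the
-- parameters introduced for formulas that occur only in a premise are bound by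
-- ∃ in the guard, witnessed by their values.

module Submission where

open import Defs
open import Data.List using (List; []; _∷_; _++_)
open import Data.Product using (Σ; _,_; _×_)
open import Data.Sum using (inj₁; inj₂; [_,_])
open import Relation.Binary.PropositionalEquality
  using (_≡_; refl; sym; trans; cong; cong₂)
import Relation.Binary.PropositionalEquality as Eq

-- Without function extensionality, every fusion law takes a substitution
-- that is merely pointwise equal to the intended composite.
module SubstitutionLemmas (S : Signature) where

  private
    liftS-var : ∀ {Γ Δ τ} {r : Ren Γ Δ} {s : Sub S Γ Δ} →
                (∀ {σ} (v : Var Γ σ) → s v ≡ var (r v)) →
                ∀ {σ} (v : Var (τ ∷ Γ) σ) → liftS S s v ≡ var (liftR r v)
    liftS-var h vz     = refl
    liftS-var h (vs v) = cong (renTerm S vs) (h v)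

  mutual
    renTerm-subTerm : ∀ {Γ Δ σ} {r : Ren Γ Δ} {s : Sub S Γ Δ} →
                      (∀ {τ} (v : Var Γ τ) → s v ≡ var (r v)) →
                      (t : Term S Γ σ) → renTerm S r t ≡ subTerm S s t
    renTerm-subTerm h (var v)    = sym (h v)
    renTerm-subTerm h (app f ts) = cong (app f) (renTerms-subTerms h ts)

    renTerms-subTerms : ∀ {Γ Δ σs} {r : Ren Γ Δ} {s : Sub S Γ Δ} →
                        (∀ {τ} (v : Var Γ τ) → s v ≡ var (r v)) →
                        (ts : Terms S Γ σs) → renTerms S r ts ≡ subTerms S s ts
    renTerms-subTerms h []       = refl
    renTerms-subTerms h (t ∷ ts) = cong₂ _∷_ (renTerm-subTerm h t) (renTerms-subTerms h ts)

  mutual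
    subTerm-∘ : ∀ {Γ Δ Θ σ} {s₁ : Sub S Γ Δ} {s₂ : Sub S Δ Θ} {s : Sub S Γ Θ} →
                (∀ {τ} (v : Var Γ τ) → s v ≡ subTerm S s₂ (s₁ v)) →
                (t : Term S Γ σ) → subTerm S s₂ (subTerm S s₁ t) ≡ subTerm S s t
    subTerm-∘ h (var v)    = sym (h v)
    subTerm-∘ h (app f ts) = cong (app f) (subTerms-∘ h ts)

    subTerms-∘ : ∀ {Γ Δ Θ σs} {s₁ : Sub S Γ Δ} {s₂ : Sub S Δ Θ} {s : Sub S Γ Θ} →
                 (∀ {τ} (v : Var Γ τ) → s v ≡ subTerm S s₂ (s₁ v)) →
                 (ts : Terms S Γ σs) → subTerms S s₂ (subTerms S s₁ ts) ≡ subTerms S s ts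
    subTerms-∘ h []       = refl
    subTerms-∘ h (t ∷ ts) = cong₂ _∷_ (subTerm-∘ h t) (subTerms-∘ h ts)

  mutual
    subTerm-id : ∀ {Γ σ} {s : Sub S Γ Γ} → (∀ {τ} (v : Var Γ τ) → s v ≡ var v) →
                 (t : Term S Γ σ) → subTerm S s t ≡ t
    subTerm-id h (var v)    = h v
    subTerm-id h (app f ts) = cong (app f) (subTerms-id h ts)

    subTerms-id : ∀ {Γ σs} {s : Sub S Γ Γ} → (∀ {τ} (v : Var Γ τ) → s v ≡ var v) →
                  (ts : Terms S Γ σs) → subTerms S s ts ≡ ts
    subTerms-id h []       = refl
    subTerms-id h (t ∷ ts) = cong₂ _∷_ (subTerm-id h t) (subTerms-id h ts)

  renTerm-id : ∀ {Γ σ} (t : Term S Γ σ) → renTerm S (λ v → v) t ≡ t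
  renTerm-id t = trans (renTerm-subTerm (λ _ → refl) t) (subTerm-id (λ _ → refl) t)

  renTerms-id : ∀ {Γ σs} (ts : Terms S Γ σs) → renTerms S (λ v → v) ts ≡ ts
  renTerms-id ts = trans (renTerms-subTerms (λ _ → refl) ts) (subTerms-id (λ _ → refl) ts)

  subTerm-renTerm : ∀ {Γ Δ Θ σ} {r : Ren Γ Δ} {s₂ : Sub S Δ Θ} {s : Sub S Γ Θ} →
                    (∀ {τ} (v : Var Γ τ) → s v ≡ s₂ (r v)) →
                    (t : Term S Γ σ) → subTerm S s₂ (renTerm S r t) ≡ subTerm S s t
  subTerm-renTerm h t =
    trans (cong (subTerm S _) (renTerm-subTerm (λ _ → refl) t)) (subTerm-∘ h t)

  renTerm-subTerm-∘ : ∀ {Γ Δ Θ σ} {s₁ : Sub S Γ Δ} {r : Ren Δ Θ} (t : Term S Γ σ) →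
                      renTerm S r (subTerm S s₁ t) ≡ subTerm S (λ v → renTerm S r (s₁ v)) t
  renTerm-subTerm-∘ {s₁ = s₁} t =
    trans (renTerm-subTerm (λ _ → refl) (subTerm S s₁ t))
          (subTerm-∘ (λ v → renTerm-subTerm (λ _ → refl) (s₁ v)) t)

  private
    liftS-∘ : ∀ {Γ Δ Θ τ} {s₁ : Sub S Γ Δ} {s₂ : Sub S Δ Θ} {s : Sub S Γ Θ} →
              (∀ {σ} (v : Var Γ σ) → s v ≡ subTerm S s₂ (s₁ v)) →
              ∀ {σ} (v : Var (τ ∷ Γ) σ) → liftS S s v ≡ subTerm S (liftS S s₂) (liftS S s₁ v)
    liftS-∘ h vz = refl
    liftS-∘ {s₁ = s₁} {s₂} h (vs v) =
      trans (cong (renTerm S vs) (h v))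
            (trans (renTerm-subTerm-∘ (s₁ v)) (sym (subTerm-renTerm (λ _ → refl) (s₁ v))))

    liftS-id : ∀ {Γ τ} {s : Sub S Γ Γ} → (∀ {σ} (v : Var Γ σ) → s v ≡ var v) →
               ∀ {σ} (v : Var (τ ∷ Γ) σ) → liftS S s v ≡ var v
    liftS-id h vz     = refl
    liftS-id h (vs v) = cong (renTerm S vs) (h v)

  renAtom-subAtom : ∀ {Γ Δ} {r : Ren Γ Δ} {s : Sub S Γ Δ} →
                    (∀ {τ} (v : Var Γ τ) → s v ≡ var (r v)) →
                    (θ : Atomic S Γ) → renAtom S r θ ≡ subAtom S s θ
  renAtom-subAtom h (rel R ts) = cong (rel R) (renTerms-subTerms h ts)
  renAtom-subAtom h (t ≐ u)    = cong₂ _≐_ (renTerm-subTerm h t) (renTerm-subTerm h u)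

  subAtom-∘ : ∀ {Γ Δ Θ} {s₁ : Sub S Γ Δ} {s₂ : Sub S Δ Θ} {s : Sub S Γ Θ} →
              (∀ {τ} (v : Var Γ τ) → s v ≡ subTerm S s₂ (s₁ v)) →
              (θ : Atomic S Γ) → subAtom S s₂ (subAtom S s₁ θ) ≡ subAtom S s θ
  subAtom-∘ h (rel R ts) = cong (rel R) (subTerms-∘ h ts)
  subAtom-∘ h (t ≐ u)    = cong₂ _≐_ (subTerm-∘ h t) (subTerm-∘ h u)

  subAtom-id : ∀ {Γ} {s : Sub S Γ Γ} → (∀ {τ} (v : Var Γ τ) → s v ≡ var v) →
               (θ : Atomic S Γ) → subAtom S s θ ≡ θ
  subAtom-id h (rel R ts) = cong (rel R) (subTerms-id h ts)
  subAtom-id h (t ≐ u)    = cong₂ _≐_ (subTerm-id h t) (subTerm-id h u)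

  renForm-subForm : ∀ {Γ Δ} {r : Ren Γ Δ} {s : Sub S Γ Δ} →
                    (∀ {τ} (v : Var Γ τ) → s v ≡ var (r v)) →
                    (φ : Formula S Γ) → renForm S r φ ≡ subForm S s φ
  renForm-subForm h (atom θ) = cong atom (renAtom-subAtom h θ)
  renForm-subForm h ⊤ᶠ       = refl
  renForm-subForm h ⊥ᶠ       = refl
  renForm-subForm h (φ ∧ᶠ ψ) = cong₂ _∧ᶠ_ (renForm-subForm h φ) (renForm-subForm h ψ)
  renForm-subForm h (φ ∨ᶠ ψ) = cong₂ _∨ᶠ_ (renForm-subForm h φ) (renForm-subForm h ψ)
  renForm-subForm h (φ ⇒ᶠ ψ) = cong₂ _⇒ᶠ_ (renForm-subForm h φ) (renForm-subForm h ψ)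
  renForm-subForm h (∃ᶠ τ φ) = cong (∃ᶠ τ) (renForm-subForm (liftS-var h) φ)
  renForm-subForm h (∀ᶠ τ φ) = cong (∀ᶠ τ) (renForm-subForm (liftS-var h) φ)

  subForm-∘ : ∀ {Γ Δ Θ} {s₁ : Sub S Γ Δ} {s₂ : Sub S Δ Θ} {s : Sub S Γ Θ} →
              (∀ {τ} (v : Var Γ τ) → s v ≡ subTerm S s₂ (s₁ v)) →
              (φ : Formula S Γ) → subForm S s₂ (subForm S s₁ φ) ≡ subForm S s φ
  subForm-∘ h (atom θ) = cong atom (subAtom-∘ h θ)
  subForm-∘ h ⊤ᶠ       = refl
  subForm-∘ h ⊥ᶠ       = refl
  subForm-∘ h (φ ∧ᶠ ψ) = cong₂ _∧ᶠ_ (subForm-∘ h φ) (subForm-∘ h ψ)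
  subForm-∘ h (φ ∨ᶠ ψ) = cong₂ _∨ᶠ_ (subForm-∘ h φ) (subForm-∘ h ψ)
  subForm-∘ h (φ ⇒ᶠ ψ) = cong₂ _⇒ᶠ_ (subForm-∘ h φ) (subForm-∘ h ψ)
  subForm-∘ h (∃ᶠ τ φ) = cong (∃ᶠ τ) (subForm-∘ (liftS-∘ h) φ)
  subForm-∘ h (∀ᶠ τ φ) = cong (∀ᶠ τ) (subForm-∘ (liftS-∘ h) φ)

  subForm-id : ∀ {Γ} {s : Sub S Γ Γ} → (∀ {τ} (v : Var Γ τ) → s v ≡ var v) →
               (φ : Formula S Γ) → subForm S s φ ≡ φ
  subForm-id h (atom θ) = cong atom (subAtom-id h θ)
  subForm-id h ⊤ᶠ       = refl
  subForm-id h ⊥ᶠ       = refl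
  subForm-id h (φ ∧ᶠ ψ) = cong₂ _∧ᶠ_ (subForm-id h φ) (subForm-id h ψ)
  subForm-id h (φ ∨ᶠ ψ) = cong₂ _∨ᶠ_ (subForm-id h φ) (subForm-id h ψ)
  subForm-id h (φ ⇒ᶠ ψ) = cong₂ _⇒ᶠ_ (subForm-id h φ) (subForm-id h ψ)
  subForm-id h (∃ᶠ τ φ) = cong (∃ᶠ τ) (subForm-id (liftS-id h) φ)
  subForm-id h (∀ᶠ τ φ) = cong (∀ᶠ τ) (subForm-id (liftS-id h) φ)

  subForm-cong : ∀ {Γ Δ} {s s′ : Sub S Γ Δ} → (∀ {τ} (v : Var Γ τ) → s v ≡ s′ v) →
                 (φ : Formula S Γ) → subForm S s φ ≡ subForm S s′ φ
  subForm-cong {s = s} h φ =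
    trans (sym (cong (subForm S s) (subForm-id (λ _ → refl) φ))) (subForm-∘ (λ v → sym (h v)) φ)

  subForm-renForm : ∀ {Γ Δ Θ} {r : Ren Γ Δ} {s₂ : Sub S Δ Θ} {s : Sub S Γ Θ} →
                    (∀ {τ} (v : Var Γ τ) → s v ≡ s₂ (r v)) →
                    (φ : Formula S Γ) → subForm S s₂ (renForm S r φ) ≡ subForm S s φ
  subForm-renForm h φ =
    trans (cong (subForm S _) (renForm-subForm (λ _ → refl) φ)) (subForm-∘ h φ)

  renForm-∘ : ∀ {Γ Δ Θ} {r₁ : Ren Γ Δ} {r₂ : Ren Δ Θ} {r : Ren Γ Θ} →
              (∀ {τ} (v : Var Γ τ) → r v ≡ r₂ (r₁ v)) →
              (φ : Formula S Γ) → renForm S r₂ (renForm S r₁ φ) ≡ renForm S r φ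
  renForm-∘ h φ =
    trans (renForm-subForm (λ _ → refl) _)
          (trans (subForm-renForm (λ v → cong var (h v)) φ) (sym (renForm-subForm (λ _ → refl) φ)))

  renForm-cong : ∀ {Γ Δ} {r r′ : Ren Γ Δ} → (∀ {τ} (v : Var Γ τ) → r v ≡ r′ v) →
                 (φ : Formula S Γ) → renForm S r φ ≡ renForm S r′ φ
  renForm-cong h φ =
    trans (renForm-subForm (λ _ → refl) φ) (sym (renForm-subForm (λ v → cong var (h v)) φ))

  renForm-id : ∀ {Γ} {r : Ren Γ Γ} → (∀ {τ} (v : Var Γ τ) → r v ≡ v) →
               (φ : Formula S Γ) → renForm S r φ ≡ φ
  renForm-id h φ = trans (renForm-subForm (λ v → cong var (sym (h v))) φ) (subForm-id (λ _ → refl) φ)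

splitVar-injL : {X : Set} {Γ Δ : List X} {σ : X} (u : Var Γ σ) → splitVar Γ {Δ} (injL u) ≡ inj₁ u
splitVar-injL {Γ = τ ∷ Γ} vz = refl
splitVar-injL {Γ = τ ∷ Γ} {Δ} (vs u) rewrite splitVar-injL {Γ = Γ} {Δ} u = refl

splitVar-injR : {X : Set} (Γ : List X) {Δ : List X} {σ : X} (w : Var Δ σ) → splitVar Γ (injR Γ w) ≡ inj₂ w
splitVar-injR []      w = refl
splitVar-injR (τ ∷ Γ) w rewrite splitVar-injR Γ w = refl

module DerivedRules (S : Signature) (T : Theory S) where
  open SubstitutionLemmas S

  cast : ∀ {Γ} {φ φ′ ψ ψ′ : Formula S Γ} → φ ≡ φ′ → ψ ≡ ψ′ → Der S T Γ φ ψ → Der S T Γ φ′ ψ′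
  cast refl refl d = d

  infixl 5 _⨾_
  _⨾_ : ∀ {Γ} {φ ψ χ : Formula S Γ} → Der S T Γ φ ψ → Der S T Γ ψ χ → Der S T Γ φ χ
  _⨾_ = cut

  ∧-swap : ∀ {Γ} {φ ψ : Formula S Γ} → Der S T Γ (φ ∧ᶠ ψ) (ψ ∧ᶠ φ)
  ∧-swap = ∧-intro ∧-elim₂ ∧-elim₁

  rename : ∀ {Γ Δ} {φ ψ : Formula S Γ} (r : Ren Γ Δ) →
           Der S T Γ φ ψ → Der S T Δ (renForm S r φ) (renForm S r ψ)
  rename r d = cast (sym (renForm-subForm (λ _ → refl) _)) (sym (renForm-subForm (λ _ → refl) _))
                    (subst (λ v → var (r v)) d)

  single : ∀ {Γ τ} → Term S Γ τ → Sub S (τ ∷ Γ) Γ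
  single t vz     = t
  single t (vs v) = var v

  ≐-refl : ∀ {Γ τ} {φ : Formula S Γ} (t : Term S Γ τ) → Der S T Γ φ (atom (t ≐ t))
  ≐-refl t = ⊤-intro ⨾ subst (single t) eq-refl

  ∃-intro : ∀ {Γ τ} {χ : Formula S Γ} {φ : Formula S (τ ∷ Γ)} (t : Term S Γ τ) →
            Der S T Γ χ (subForm S (single t) φ) → Der S T Γ χ (∃ᶠ τ φ)
  ∃-intro {φ = φ} t d =
    d ⨾ cast refl (trans (subForm-renForm (λ _ → refl) (∃ᶠ _ φ)) (subForm-id (λ _ → refl) (∃ᶠ _ φ)))
             (subst (single t) (∃-left⁻ ident))

  ∧∃-left : ∀ {Γ τ} {χ ψ : Formula S Γ} {φ : Formula S (τ ∷ Γ)} →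
            Der S T (τ ∷ Γ) (renForm S vs χ ∧ᶠ φ) (renForm S vs ψ) → Der S T Γ (χ ∧ᶠ ∃ᶠ τ φ) ψ
  ∧∃-left d = ⇒-elim (∃-left (⇒-intro (∃-left⁻ ident))) ⨾ ∃-left d

  ∧∃-left⁻ : ∀ {Γ τ} {χ ψ : Formula S Γ} {φ : Formula S (τ ∷ Γ)} →
             Der S T Γ (χ ∧ᶠ ∃ᶠ τ φ) ψ → Der S T (τ ∷ Γ) (renForm S vs χ ∧ᶠ φ) (renForm S vs ψ)
  ∧∃-left⁻ d = ⇒-elim (∃-left⁻ (⇒-intro d))

  ∃∧-left : ∀ {Γ τ} {φ ψ : Formula S Γ} {χ : Formula S (τ ∷ Γ)} →
            Der S T (τ ∷ Γ) (χ ∧ᶠ renForm S vs φ) (renForm S vs ψ) → Der S T Γ (∃ᶠ τ χ ∧ᶠ φ) ψ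
  ∃∧-left d = ∧-swap ⨾ ∧∃-left (∧-swap ⨾ d)

  ∀-mono : ∀ {Γ τ} {χ : Formula S Γ} {φ ψ : Formula S (τ ∷ Γ)} →
           Der S T (τ ∷ Γ) (renForm S vs χ ∧ᶠ φ) ψ → Der S T Γ (χ ∧ᶠ ∀ᶠ τ φ) (∀ᶠ τ ψ)
  ∀-mono d = ∀-right (∧-intro ∧-elim₁ (∧-elim₂ ⨾ ∀-right⁻ ident) ⨾ d)

  leibniz : ∀ {Γ τ} (φ : Formula S (τ ∷ Γ)) (t u : Term S Γ τ) →
            Der S T Γ (atom (t ≐ u) ∧ᶠ subForm S (single t) φ) (subForm S (single u) φ)
  leibniz {Γ} {τ} φ t u =
    cast (cong (atom (t ≐ u) ∧ᶠ_) (subForm-renForm at-t φ)) (subForm-renForm at-u φ) (subst s (eq-subst φ))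
    where
      s : Sub S (τ ∷ τ ∷ Γ) Γ
      s vz          = u
      s (vs vz)     = t
      s (vs (vs v)) = var v
      at-t : ∀ {σ} (v : Var (τ ∷ Γ) σ) → single t v ≡ s (eqR₀ S v)
      at-t vz     = refl
      at-t (vs v) = refl
      at-u : ∀ {σ} (v : Var (τ ∷ Γ) σ) → single u v ≡ s (eqR₁ S v)
      at-u vz     = refl
      at-u (vs v) = refl

  lookupTerm : ∀ {Γ σs σ} → Terms S Γ σs → Var σs σ → Term S Γ σ
  lookupTerm (t ∷ ts) vz     = t
  lookupTerm (t ∷ ts) (vs v) = lookupTerm ts v

  prependSub : ∀ {Γ σs} → Terms S Γ σs → Sub S (σs ++ Γ) Γ
  prependSub {σs = σs} ts v = [ lookupTerm ts , var ] (splitVar σs v)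

  prependSub-vs : ∀ {Γ σ σs} (t : Term S Γ σ) (ts : Terms S Γ σs) {ρ} (v : Var (σs ++ Γ) ρ) →
                  prependSub (t ∷ ts) (vs v) ≡ prependSub ts v
  prependSub-vs {σs = σs} t ts v with splitVar σs v
  ... | inj₁ w = refl
  ... | inj₂ w = refl

  prependSub-injL : ∀ {Γ σs} (ts : Terms S Γ σs) {ρ} (w : Var σs ρ) → prependSub ts (injL w) ≡ lookupTerm ts w
  prependSub-injL {Γ} {σs} ts w rewrite splitVar-injL {Γ = σs} {Γ} w = refl

  prependSub-injR : ∀ {Γ σs} (ts : Terms S Γ σs) {ρ} (w : Var Γ ρ) → prependSub ts (injR σs w) ≡ var w
  prependSub-injR {σs = σs} ts w rewrite splitVar-injR σs w = refl

  subTerm-prependSub-injR : ∀ {Γ σs σ} (ts : Terms S Γ σs) (t : Term S Γ σ) →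
                            subTerm S (prependSub ts) (renTerm S (injR σs) t) ≡ t
  subTerm-prependSub-injR ts t =
    trans (subTerm-renTerm (λ w → sym (prependSub-injR ts w)) t) (subTerm-id (λ _ → refl) t)

  _≐⋆_ : ∀ {Γ σs} → Terms S Γ σs → Terms S Γ σs → Formula S Γ
  []       ≐⋆ []       = ⊤ᶠ
  (t ∷ ts) ≐⋆ (u ∷ us) = atom (t ≐ u) ∧ᶠ (ts ≐⋆ us)

  leibniz⋆ : ∀ {Γ σs} (φ : Formula S (σs ++ Γ)) (ts us : Terms S Γ σs) →
             Der S T Γ ((ts ≐⋆ us) ∧ᶠ subForm S (prependSub ts) φ) (subForm S (prependSub us) φ)
  leibniz⋆ φ [] [] = ∧-elim₂
  leibniz⋆ {Γ} {σ ∷ σs} φ (t ∷ ts) (u ∷ us) =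
    ∧-intro (∧-elim₁ ⨾ ∧-elim₁) (∧-intro (∧-elim₁ ⨾ ∧-elim₂) ∧-elim₂ ⨾ replace-tail)
    ⨾ cast (cong (atom (t ≐ u) ∧ᶠ_) (head-form t)) (head-form u) (leibniz φ-head t u)
    where
      -- first fix the head at t and replace the tail ts by us, then replace the head
      fix-head : Sub S (σ ∷ (σs ++ Γ)) (σs ++ Γ)
      fix-head vz     = renTerm S (injR σs) t
      fix-head (vs v) = var v
      tail-form : ∀ xs → subForm S (prependSub xs) (subForm S fix-head φ) ≡ subForm S (prependSub (t ∷ xs)) φ
      tail-form xs = subForm-∘ at φ
        where
          at : ∀ {ρ} (v : Var (σ ∷ (σs ++ Γ)) ρ) → prependSub (t ∷ xs) v ≡ subTerm S (prependSub xs) (fix-head v)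
          at vz     = sym (subTerm-prependSub-injR xs t)
          at (vs v) = prependSub-vs t xs v
      replace-tail : Der S T Γ ((ts ≐⋆ us) ∧ᶠ subForm S (prependSub (t ∷ ts)) φ) (subForm S (prependSub (t ∷ us)) φ)
      replace-tail = cast (cong ((ts ≐⋆ us) ∧ᶠ_) (tail-form ts)) (tail-form us) (leibniz⋆ (subForm S fix-head φ) ts us)
      φ-head : Formula S (σ ∷ Γ)
      φ-head = subForm S (liftS S (prependSub us)) φ
      head-form : ∀ x → subForm S (single x) φ-head ≡ subForm S (prependSub (x ∷ us)) φ
      head-form x = subForm-∘ at φ
        where
          at : ∀ {ρ} (v : Var (σ ∷ (σs ++ Γ)) ρ) → prependSub (x ∷ us) v ≡ subTerm S (single x) (liftS S (prependSub us) v)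
          at vz     = refl
          at (vs v) = trans (prependSub-vs x us v)
                            (sym (trans (subTerm-renTerm (λ _ → refl) (prependSub us v)) (subTerm-id (λ _ → refl) _)))

  variables : ∀ {Θ} (σs : Ctx S) → Ren σs Θ → Terms S Θ σs
  variables []       r = []
  variables (σ ∷ σs) r = var (r vz) ∷ variables σs (λ v → r (vs v))

  subTerms-variables : ∀ {Θ Γ σs} (r : Ren σs Θ) (s : Sub S Θ Γ) (ts : Terms S Γ σs) →
                       (∀ {ρ} (v : Var σs ρ) → s (r v) ≡ lookupTerm ts v) → subTerms S s (variables σs r) ≡ ts
  subTerms-variables r s []       h = refl
  subTerms-variables r s (t ∷ ts) h = cong₂ _∷_ (h vz) (subTerms-variables (λ v → r (vs v)) s ts (λ v → h (vs v)))

  prependSub-variables : ∀ {Γ σs} (ts : Terms S Γ σs) → subTerms S (prependSub ts) (variables σs injL) ≡ ts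
  prependSub-variables ts = subTerms-variables injL (prependSub ts) ts (prependSub-injL ts)

  rel-cong : ∀ {Γ} (R : Rel S) (ts us : Terms S Γ (rdom S R)) →
             Der S T Γ ((ts ≐⋆ us) ∧ᶠ atom (rel R ts)) (atom (rel R us))
  rel-cong {Γ} R ts us = cast (cong ((ts ≐⋆ us) ∧ᶠ_) (at ts)) (at us) (leibniz⋆ φ ts us)
    where
      φ : Formula S (rdom S R ++ Γ)
      φ = atom (rel R (variables (rdom S R) injL))
      at : ∀ xs → subForm S (prependSub xs) φ ≡ atom (rel R xs)
      at xs = cong (λ z → atom (rel R z)) (prependSub-variables xs)

  app-cong : ∀ {Γ} (f : Fun S) (ts us : Terms S Γ (dom S f)) →
             Der S T Γ (ts ≐⋆ us) (atom (app f ts ≐ app f us))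
  app-cong {Γ} f ts us =
    ∧-intro ident (≐-refl (app f ts)) ⨾ cast (cong ((ts ≐⋆ us) ∧ᶠ_) (at ts)) (at us) (leibniz⋆ φ ts us)
    where
      φ : Formula S (dom S f ++ Γ)
      φ = atom (renTerm S (injR (dom S f)) (app f ts) ≐ app f (variables (dom S f) injL))
      at : ∀ xs → subForm S (prependSub xs) φ ≡ atom (app f ts ≐ app f xs)
      at xs = cong₂ (λ l r → atom (l ≐ app f r)) (subTerm-prependSub-injR xs (app f ts)) (prependSub-variables xs)

  ≐-cong : ∀ {Γ σ} (t₀ u₀ t₁ u₁ : Term S Γ σ) →
           Der S T Γ (((t₀ ∷ u₀ ∷ []) ≐⋆ (t₁ ∷ u₁ ∷ [])) ∧ᶠ atom (t₀ ≐ u₀)) (atom (t₁ ≐ u₁))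
  ≐-cong {σ = σ} t₀ u₀ t₁ u₁ =
    leibniz⋆ {σs = σ ∷ σ ∷ []} (atom (var vz ≐ var (vs vz))) (t₀ ∷ u₀ ∷ []) (t₁ ∷ u₁ ∷ [])

liftR⋆ : {X : Set} (Γ : List X) {Δ Δ′ : List X} → Ren Δ Δ′ → Ren (Γ ++ Δ) (Γ ++ Δ′)
liftR⋆ []      r v      = r v
liftR⋆ (τ ∷ Γ) r vz     = vz
liftR⋆ (τ ∷ Γ) r (vs v) = vs (liftR⋆ Γ r v)

liftR⋆-injL : {X : Set} (Γ : List X) {Δ Δ′ : List X} (r : Ren Δ Δ′) {σ : X} (u : Var Γ σ) →
              liftR⋆ Γ r (injL u) ≡ injL u
liftR⋆-injL (τ ∷ Γ) r vz     = refl
liftR⋆-injL (τ ∷ Γ) r (vs u) = cong vs (liftR⋆-injL Γ r u)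

liftR⋆-injR : {X : Set} (Γ : List X) {Δ Δ′ : List X} (r : Ren Δ Δ′) {σ : X} (w : Var Δ σ) →
              liftR⋆ Γ r (injR Γ w) ≡ injR Γ (r w)
liftR⋆-injR []      r w = refl
liftR⋆-injR (τ ∷ Γ) r w = cong vs (liftR⋆-injR Γ r w)

liftR⋆-∘ : {X : Set} (Γ : List X) {Δ Δ′ Δ″ : List X} (r₁ : Ren Δ Δ′) (r₂ : Ren Δ′ Δ″) {σ : X}
           (v : Var (Γ ++ Δ) σ) → liftR⋆ Γ (λ w → r₂ (r₁ w)) v ≡ liftR⋆ Γ r₂ (liftR⋆ Γ r₁ v)
liftR⋆-∘ []      r₁ r₂ v      = refl
liftR⋆-∘ (τ ∷ Γ) r₁ r₂ vz     = refl
liftR⋆-∘ (τ ∷ Γ) r₁ r₂ (vs v) = cong vs (liftR⋆-∘ Γ r₁ r₂ v)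

liftR⋆-id : {X : Set} (Γ : List X) {Δ : List X} {σ : X} (v : Var (Γ ++ Δ) σ) → liftR⋆ Γ (λ w → w) v ≡ v
liftR⋆-id []      v      = refl
liftR⋆-id (τ ∷ Γ) vz     = refl
liftR⋆-id (τ ∷ Γ) (vs v) = cong vs (liftR⋆-id Γ v)

hoist : {X : Set} (Γ : List X) {Δ : List X} {τ : X} → Ren (Γ ++ τ ∷ Δ) (τ ∷ Γ ++ Δ)
hoist []      v      = v
hoist (σ ∷ Γ) vz     = vs vz
hoist (σ ∷ Γ) (vs v) = liftR vs (hoist Γ v)

hoist-liftR⋆ : {X : Set} (Γ : List X) {Δ : List X} {τ σ : X} (v : Var (Γ ++ Δ) σ) →
               hoist Γ {τ = τ} (liftR⋆ Γ vs v) ≡ vs v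
hoist-liftR⋆ []      v      = refl
hoist-liftR⋆ (σ ∷ Γ) vz     = refl
hoist-liftR⋆ (σ ∷ Γ) (vs v) = cong (liftR vs) (hoist-liftR⋆ Γ v)

hoist-injR : {X : Set} (Γ : List X) {Δ : List X} {τ σ : X} (w : Var (τ ∷ Δ) σ) →
             hoist Γ (injR Γ w) ≡ liftR (injR Γ) w
hoist-injR []      vz     = refl
hoist-injR []      (vs w) = refl
hoist-injR (σ ∷ Γ) vz     = cong (liftR vs) (hoist-injR Γ vz)
hoist-injR (σ ∷ Γ) (vs w) = cong (liftR vs) (hoist-injR Γ (vs w))

data Suffix {X : Set} : List X → List X → Set where
  here  : ∀ {Δ} → Suffix Δ Δ
  there : ∀ {Δ Δ′ τ} → Suffix Δ Δ′ → Suffix Δ (τ ∷ Δ′)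

weaken : {X : Set} {Δ Δ′ : List X} → Suffix Δ Δ′ → Ren Δ Δ′
weaken here      v = v
weaken (there p) v = vs (weaken p v)

Suffix-trans : {X : Set} {Δ₁ Δ₂ Δ₃ : List X} → Suffix Δ₁ Δ₂ → Suffix Δ₂ Δ₃ → Suffix Δ₁ Δ₃
Suffix-trans p here      = p
Suffix-trans p (there q) = there (Suffix-trans p q)

weaken-trans : {X : Set} {Δ₁ Δ₂ Δ₃ : List X} (p : Suffix Δ₁ Δ₂) (q : Suffix Δ₂ Δ₃) {σ : X} (v : Var Δ₁ σ) →
               weaken (Suffix-trans p q) v ≡ weaken q (weaken p v)
weaken-trans p here      v = refl
weaken-trans p (there q) v = cong vs (weaken-trans p q v)

-- AbsForm a φ₀ φ: φ₀ arises from the Σ+|A|-formula φ by replacing every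
-- constant b by a variable w of the parameter context Δ with a w ≡ b.
-- Different occurrences of b may be replaced by different variables, so
-- abstractions are not unique; they are only equivalent given the true
-- equations between the parameters.
module Abstraction (S : Signature) (A : Structure S) where

  E : Signature
  E = extend S A

  mutual
    data AbsTerm {Δ : Ctx S} (a : Env A Δ) {Γ : Ctx S} : ∀ {σ} → Term S (Γ ++ Δ) σ → Term E Γ σ → Set where
      abs-var   : ∀ {σ} (u : Var Γ σ) → AbsTerm a (var (injL u)) (var u)
      abs-const : ∀ {σ} (w : Var Δ σ) {b : Carrier A σ} → a w ≡ b → AbsTerm a (var (injR Γ w)) (const b)
      abs-app   : ∀ (f : Fun S) {ts₀ ts} → AbsTerms a ts₀ ts → AbsTerm a (app f ts₀) (app (inj₁ f) ts)

    data AbsTerms {Δ : Ctx S} (a : Env A Δ) {Γ : Ctx S} : ∀ {σs} → Terms S (Γ ++ Δ) σs → Terms E Γ σs → Set where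
      []  : AbsTerms a [] []
      _∷_ : ∀ {σ σs} {t₀ : Term S (Γ ++ Δ) σ} {t : Term E Γ σ} {ts₀ : Terms S (Γ ++ Δ) σs} {ts : Terms E Γ σs} →
            AbsTerm a t₀ t → AbsTerms a ts₀ ts → AbsTerms a (t₀ ∷ ts₀) (t ∷ ts)

  data AbsAtom {Δ : Ctx S} (a : Env A Δ) {Γ : Ctx S} : Atomic S (Γ ++ Δ) → Atomic E Γ → Set where
    abs-rel : (R : Rel S) {ts₀ : Terms S (Γ ++ Δ) (rdom S R)} {ts : Terms E Γ (rdom S R)} →
              AbsTerms a ts₀ ts → AbsAtom a (rel R ts₀) (rel R ts)
    abs-≐   : ∀ {σ} {t₀ u₀ : Term S (Γ ++ Δ) σ} {t u : Term E Γ σ} →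
              AbsTerm a t₀ t → AbsTerm a u₀ u → AbsAtom a (t₀ ≐ u₀) (t ≐ u)

  data AbsForm {Δ : Ctx S} (a : Env A Δ) : {Γ : Ctx S} → Formula S (Γ ++ Δ) → Formula E Γ → Set where
    abs-atom : ∀ {Γ θ₀ θ} → AbsAtom a {Γ} θ₀ θ → AbsForm a (atom θ₀) (atom θ)
    abs-⊤    : ∀ {Γ} → AbsForm a {Γ} ⊤ᶠ ⊤ᶠ
    abs-⊥    : ∀ {Γ} → AbsForm a {Γ} ⊥ᶠ ⊥ᶠ
    abs-∧    : ∀ {Γ φ₀ ψ₀ φ ψ} → AbsForm a {Γ} φ₀ φ → AbsForm a ψ₀ ψ → AbsForm a (φ₀ ∧ᶠ ψ₀) (φ ∧ᶠ ψ)
    abs-∨    : ∀ {Γ φ₀ ψ₀ φ ψ} → AbsForm a {Γ} φ₀ φ → AbsForm a ψ₀ ψ → AbsForm a (φ₀ ∨ᶠ ψ₀) (φ ∨ᶠ ψ)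
    abs-⇒    : ∀ {Γ φ₀ ψ₀ φ ψ} → AbsForm a {Γ} φ₀ φ → AbsForm a ψ₀ ψ → AbsForm a (φ₀ ⇒ᶠ ψ₀) (φ ⇒ᶠ ψ)
    abs-∃    : ∀ {Γ τ φ₀ φ} → AbsForm a {τ ∷ Γ} φ₀ φ → AbsForm a {Γ} (∃ᶠ τ φ₀) (∃ᶠ τ φ)
    abs-∀    : ∀ {Γ τ φ₀ φ} → AbsForm a {τ ∷ Γ} φ₀ φ → AbsForm a {Γ} (∀ᶠ τ φ₀) (∀ᶠ τ φ)

  module _ {Δ₁ Δ₂ : Ctx S} {a₁ : Env A Δ₁} {a₂ : Env A Δ₂}
           (ρΔ : Ren Δ₁ Δ₂) (ρΔ-env : ∀ {σ} (w : Var Δ₁ σ) → a₂ (ρΔ w) ≡ a₁ w) where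

    SplitsAs : ∀ {Γ₁ Γ₂ : Ctx S} → Ren (Γ₁ ++ Δ₁) (Γ₂ ++ Δ₂) → Ren Γ₁ Γ₂ → Set
    SplitsAs {Γ₁} {Γ₂} ρ ρΓ = (∀ {σ} (u : Var Γ₁ σ) → ρ (injL u) ≡ injL (ρΓ u))
                            × (∀ {σ} (w : Var Δ₁ σ) → ρ (injR Γ₁ w) ≡ injR Γ₂ (ρΔ w))

    SplitsAs-liftR : ∀ {Γ₁ Γ₂ τ} {ρ : Ren (Γ₁ ++ Δ₁) (Γ₂ ++ Δ₂)} {ρΓ : Ren Γ₁ Γ₂} →
                     SplitsAs ρ ρΓ → SplitsAs {τ ∷ Γ₁} {τ ∷ Γ₂} (liftR ρ) (liftR ρΓ)
    SplitsAs-liftR (onΓ , onΔ) = (λ { vz → refl ; (vs u) → cong vs (onΓ u) }) , (λ w → cong vs (onΔ w))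

    mutual
      renAbsTerm : ∀ {Γ₁ Γ₂ σ} {ρ : Ren (Γ₁ ++ Δ₁) (Γ₂ ++ Δ₂)} {ρΓ : Ren Γ₁ Γ₂} → SplitsAs ρ ρΓ →
                   {t₀ : Term S (Γ₁ ++ Δ₁) σ} {t : Term E Γ₁ σ} →
                   AbsTerm a₁ t₀ t → AbsTerm a₂ (renTerm S ρ t₀) (renTerm E ρΓ t)
      renAbsTerm {ρΓ = ρΓ} (onΓ , onΔ) (abs-var u) =
        Eq.subst (λ x → AbsTerm a₂ (var x) (var (ρΓ u))) (sym (onΓ u)) (abs-var (ρΓ u))
      renAbsTerm (onΓ , onΔ) (abs-const w {b} p) =
        Eq.subst (λ x → AbsTerm a₂ (var x) (const b)) (sym (onΔ w)) (abs-const (ρΔ w) (trans (ρΔ-env w) p))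
      renAbsTerm ρ≈ (abs-app f rs) = abs-app f (renAbsTerms ρ≈ rs)

      renAbsTerms : ∀ {Γ₁ Γ₂ σs} {ρ : Ren (Γ₁ ++ Δ₁) (Γ₂ ++ Δ₂)} {ρΓ : Ren Γ₁ Γ₂} → SplitsAs ρ ρΓ →
                    {ts₀ : Terms S (Γ₁ ++ Δ₁) σs} {ts : Terms E Γ₁ σs} →
                    AbsTerms a₁ ts₀ ts → AbsTerms a₂ (renTerms S ρ ts₀) (renTerms E ρΓ ts)
      renAbsTerms ρ≈ []       = []
      renAbsTerms ρ≈ (r ∷ rs) = renAbsTerm ρ≈ r ∷ renAbsTerms ρ≈ rs

    renAbsAtom : ∀ {Γ₁ Γ₂} {ρ : Ren (Γ₁ ++ Δ₁) (Γ₂ ++ Δ₂)} {ρΓ : Ren Γ₁ Γ₂} → SplitsAs ρ ρΓ →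
                 {θ₀ : Atomic S (Γ₁ ++ Δ₁)} {θ : Atomic E Γ₁} →
                 AbsAtom a₁ θ₀ θ → AbsAtom a₂ (renAtom S ρ θ₀) (renAtom E ρΓ θ)
    renAbsAtom ρ≈ (abs-rel R rs) = abs-rel R (renAbsTerms ρ≈ rs)
    renAbsAtom ρ≈ (abs-≐ r r′)   = abs-≐ (renAbsTerm ρ≈ r) (renAbsTerm ρ≈ r′)

    renAbsForm : ∀ {Γ₁ Γ₂} {ρ : Ren (Γ₁ ++ Δ₁) (Γ₂ ++ Δ₂)} {ρΓ : Ren Γ₁ Γ₂} → SplitsAs ρ ρΓ →
                 {φ₀ : Formula S (Γ₁ ++ Δ₁)} {φ : Formula E Γ₁} →
                 AbsForm a₁ φ₀ φ → AbsForm a₂ (renForm S ρ φ₀) (renForm E ρΓ φ)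
    renAbsForm ρ≈ (abs-atom r)  = abs-atom (renAbsAtom ρ≈ r)
    renAbsForm ρ≈ abs-⊤         = abs-⊤
    renAbsForm ρ≈ abs-⊥         = abs-⊥
    renAbsForm ρ≈ (abs-∧ r r′)  = abs-∧ (renAbsForm ρ≈ r) (renAbsForm ρ≈ r′)
    renAbsForm ρ≈ (abs-∨ r r′)  = abs-∨ (renAbsForm ρ≈ r) (renAbsForm ρ≈ r′)
    renAbsForm ρ≈ (abs-⇒ r r′)  = abs-⇒ (renAbsForm ρ≈ r) (renAbsForm ρ≈ r′)
    renAbsForm ρ≈ (abs-∃ r)     = abs-∃ (renAbsForm (SplitsAs-liftR ρ≈) r)
    renAbsForm ρ≈ (abs-∀ r)     = abs-∀ (renAbsForm (SplitsAs-liftR ρ≈) r)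

  module _ {Δ : Ctx S} {a : Env A Δ} where

    renFreeAbsForm : ∀ {Γ₁ Γ₂} {ρ : Ren (Γ₁ ++ Δ) (Γ₂ ++ Δ)} {ρΓ : Ren Γ₁ Γ₂} →
                     SplitsAs {a₁ = a} {a₂ = a} (λ w → w) (λ _ → refl) ρ ρΓ →
                   {φ₀ : Formula S (Γ₁ ++ Δ)} {φ : Formula E Γ₁} →
                   AbsForm a φ₀ φ → AbsForm a (renForm S ρ φ₀) (renForm E ρΓ φ)
    renFreeAbsForm = renAbsForm {a₁ = a} {a₂ = a} (λ w → w) (λ _ → refl)

    wkAbsTerm : ∀ {Γ τ σ} {t₀ : Term S (Γ ++ Δ) σ} {t : Term E Γ σ} →
                AbsTerm a t₀ t → AbsTerm a (renTerm S (vs {τ = τ}) t₀) (renTerm E vs t)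
    wkAbsTerm = renAbsTerm {a₁ = a} {a₂ = a} (λ w → w) (λ _ → refl) ((λ _ → refl) , (λ _ → refl))

    wkAbsForm : ∀ {Γ τ} {φ₀ : Formula S (Γ ++ Δ)} {φ : Formula E Γ} →
                AbsForm a φ₀ φ → AbsForm a (renForm S (vs {τ = τ}) φ₀) (renForm E vs φ)
    wkAbsForm = renFreeAbsForm ((λ _ → refl) , (λ _ → refl))

  record Extension {Δ : Ctx S} (a : Env A Δ) : Set where
    constructor extension
    field
      {Δ⁺}      : Ctx S
      suffix    : Suffix Δ Δ⁺
      a⁺        : Env A Δ⁺
      a⁺-weaken : ∀ {σ} (v : Var Δ σ) → a⁺ (weaken suffix v) ≡ a v

  open Extension public

  Extension-refl : ∀ {Δ} (a : Env A Δ) → Extension a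
  Extension-refl a = extension here a (λ _ → refl)

  Extension-trans : ∀ {Δ} {a : Env A Δ} (e₁ : Extension a) → Extension (a⁺ e₁) → Extension a
  Extension-trans e₁ e₂ = extension (Suffix-trans (suffix e₁) (suffix e₂)) (a⁺ e₂) λ v →
    trans (cong (a⁺ e₂) (weaken-trans (suffix e₁) (suffix e₂) v))
          (trans (a⁺-weaken e₂ (weaken (suffix e₁) v)) (a⁺-weaken e₁ v))

  _∷ₑ_ : ∀ {Δ τ} → Carrier A τ → Env A Δ → Env A (τ ∷ Δ)
  (b ∷ₑ a) vz     = b
  (b ∷ₑ a) (vs v) = a v

  module _ {Δ : Ctx S} {a : Env A Δ} (e : Extension a) where

    private
      splits : ∀ {Γ} → SplitsAs {a₁ = a} {a₂ = a⁺ e} (weaken (suffix e)) (a⁺-weaken e)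
                                (liftR⋆ Γ (weaken (suffix e))) (λ u → u)
      splits {Γ} = liftR⋆-injL Γ (weaken (suffix e)) , liftR⋆-injR Γ (weaken (suffix e))

    extAbsTerm : ∀ {Γ σ} {t₀ : Term S (Γ ++ Δ) σ} {t : Term E Γ σ} →
                   AbsTerm a t₀ t → AbsTerm (a⁺ e) (renTerm S (liftR⋆ Γ (weaken (suffix e))) t₀) t
    extAbsTerm {t = t} x =
      Eq.subst (AbsTerm (a⁺ e) _) (SubstitutionLemmas.renTerm-id E t)
               (renAbsTerm (weaken (suffix e)) (a⁺-weaken e) splits x)

    extAbsTerms : ∀ {Γ σs} {ts₀ : Terms S (Γ ++ Δ) σs} {ts : Terms E Γ σs} →
                    AbsTerms a ts₀ ts → AbsTerms (a⁺ e) (renTerms S (liftR⋆ Γ (weaken (suffix e))) ts₀) ts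
    extAbsTerms {ts = ts} x =
      Eq.subst (AbsTerms (a⁺ e) _) (SubstitutionLemmas.renTerms-id E ts)
               (renAbsTerms (weaken (suffix e)) (a⁺-weaken e) splits x)

    extAbsForm : ∀ {Γ} {φ₀ : Formula S (Γ ++ Δ)} {φ : Formula E Γ} →
                   AbsForm a φ₀ φ → AbsForm (a⁺ e) (renForm S (liftR⋆ Γ (weaken (suffix e))) φ₀) φ
    extAbsForm {φ = φ} x =
      Eq.subst (AbsForm (a⁺ e) _) (SubstitutionLemmas.renForm-id E (λ _ → refl) φ)
               (renAbsForm (weaken (suffix e)) (a⁺-weaken e) splits x)

  module _ {Δ : Ctx S} {a : Env A Δ} where

    AbsSub : ∀ {Γ₁ Γ₂ : Ctx S} → Sub S (Γ₁ ++ Δ) (Γ₂ ++ Δ) → Sub E Γ₁ Γ₂ → Set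
    AbsSub {Γ₁} {Γ₂} s₀ s = (∀ {σ} (u : Var Γ₁ σ) → AbsTerm a (s₀ (injL u)) (s u))
                          × (∀ {σ} (w : Var Δ σ) → s₀ (injR Γ₁ w) ≡ var (injR Γ₂ w))

    AbsSub-liftS : ∀ {Γ₁ Γ₂ τ} {s₀ : Sub S (Γ₁ ++ Δ) (Γ₂ ++ Δ)} {s : Sub E Γ₁ Γ₂} →
                   AbsSub s₀ s → AbsSub {τ ∷ Γ₁} {τ ∷ Γ₂} (liftS S s₀) (liftS E s)
    AbsSub-liftS (onΓ , onΔ) = (λ { vz → abs-var vz ; (vs u) → wkAbsTerm (onΓ u) }) , (λ w → cong (renTerm S vs) (onΔ w))

    mutual
      subAbsTerm : ∀ {Γ₁ Γ₂ σ} {s₀ : Sub S (Γ₁ ++ Δ) (Γ₂ ++ Δ)} {s : Sub E Γ₁ Γ₂} → AbsSub s₀ s →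
                   {t₀ : Term S (Γ₁ ++ Δ) σ} {t : Term E Γ₁ σ} →
                   AbsTerm a t₀ t → AbsTerm a (subTerm S s₀ t₀) (subTerm E s t)
      subAbsTerm (onΓ , onΔ) (abs-var u)         = onΓ u
      subAbsTerm (onΓ , onΔ) (abs-const w {b} p) =
        Eq.subst (λ x → AbsTerm a x (const b)) (sym (onΔ w)) (abs-const w p)
      subAbsTerm s≈ (abs-app f rs) = abs-app f (subAbsTerms s≈ rs)

      subAbsTerms : ∀ {Γ₁ Γ₂ σs} {s₀ : Sub S (Γ₁ ++ Δ) (Γ₂ ++ Δ)} {s : Sub E Γ₁ Γ₂} → AbsSub s₀ s →
                    {ts₀ : Terms S (Γ₁ ++ Δ) σs} {ts : Terms E Γ₁ σs} →
                    AbsTerms a ts₀ ts → AbsTerms a (subTerms S s₀ ts₀) (subTerms E s ts)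
      subAbsTerms s≈ []       = []
      subAbsTerms s≈ (r ∷ rs) = subAbsTerm s≈ r ∷ subAbsTerms s≈ rs

    subAbsAtom : ∀ {Γ₁ Γ₂} {s₀ : Sub S (Γ₁ ++ Δ) (Γ₂ ++ Δ)} {s : Sub E Γ₁ Γ₂} → AbsSub s₀ s →
                 {θ₀ : Atomic S (Γ₁ ++ Δ)} {θ : Atomic E Γ₁} →
                 AbsAtom a θ₀ θ → AbsAtom a (subAtom S s₀ θ₀) (subAtom E s θ)
    subAbsAtom s≈ (abs-rel R rs) = abs-rel R (subAbsTerms s≈ rs)
    subAbsAtom s≈ (abs-≐ r r′)   = abs-≐ (subAbsTerm s≈ r) (subAbsTerm s≈ r′)

    subAbsForm : ∀ {Γ₁ Γ₂} {s₀ : Sub S (Γ₁ ++ Δ) (Γ₂ ++ Δ)} {s : Sub E Γ₁ Γ₂} → AbsSub s₀ s →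
                 {φ₀ : Formula S (Γ₁ ++ Δ)} {φ : Formula E Γ₁} →
                 AbsForm a φ₀ φ → AbsForm a (subForm S s₀ φ₀) (subForm E s φ)
    subAbsForm s≈ (abs-atom r) = abs-atom (subAbsAtom s≈ r)
    subAbsForm s≈ abs-⊤        = abs-⊤
    subAbsForm s≈ abs-⊥        = abs-⊥
    subAbsForm s≈ (abs-∧ r r′) = abs-∧ (subAbsForm s≈ r) (subAbsForm s≈ r′)
    subAbsForm s≈ (abs-∨ r r′) = abs-∨ (subAbsForm s≈ r) (subAbsForm s≈ r′)
    subAbsForm s≈ (abs-⇒ r r′) = abs-⇒ (subAbsForm s≈ r) (subAbsForm s≈ r′)
    subAbsForm s≈ (abs-∃ r)    = abs-∃ (subAbsForm (AbsSub-liftS s≈) r)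
    subAbsForm s≈ (abs-∀ r)    = abs-∀ (subAbsForm (AbsSub-liftS s≈) r)

  mutual
    abstractTerm : ∀ {Γ σ Δ} (t : Term E Γ σ) (a : Env A Δ) →
                   Σ (Extension a) λ e → Σ (Term S (Γ ++ Δ⁺ e) σ) λ t₀ → AbsTerm (a⁺ e) t₀ t
    abstractTerm (var u) a = Extension-refl a , var (injL u) , abs-var u
    abstractTerm (app (inj₁ f) ts) a with abstractTerms ts a
    ... | e , ts₀ , rs = e , app f ts₀ , abs-app f rs
    abstractTerm {Γ} (app (inj₂ (σ , b)) []) a =
      extension (there here) (b ∷ₑ a) (λ _ → refl) , var (injR Γ vz) , abs-const vz refl

    abstractTerms : ∀ {Γ σs Δ} (ts : Terms E Γ σs) (a : Env A Δ) →
                    Σ (Extension a) λ e → Σ (Terms S (Γ ++ Δ⁺ e) σs) λ ts₀ → AbsTerms (a⁺ e) ts₀ ts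
    abstractTerms [] a = Extension-refl a , [] , []
    abstractTerms {Γ} (t ∷ ts) a with abstractTerms ts a
    ... | e₁ , ts₀ , rs with abstractTerm t (a⁺ e₁)
    ... | e₂ , t₀ , r =
      Extension-trans e₁ e₂ , t₀ ∷ renTerms S (liftR⋆ Γ (weaken (suffix e₂))) ts₀ , r ∷ extAbsTerms e₂ rs

  abstractAtom : ∀ {Γ Δ} (θ : Atomic E Γ) (a : Env A Δ) →
                 Σ (Extension a) λ e → Σ (Atomic S (Γ ++ Δ⁺ e)) λ θ₀ → AbsAtom (a⁺ e) θ₀ θ
  abstractAtom (rel R ts) a with abstractTerms ts a
  ... | e , ts₀ , rs = e , rel R ts₀ , abs-rel R rs
  abstractAtom {Γ} (t ≐ u) a with abstractTerm t a
  ... | e₁ , t₀ , r with abstractTerm u (a⁺ e₁)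
  ... | e₂ , u₀ , r′ =
    Extension-trans e₁ e₂ , renTerm S (liftR⋆ Γ (weaken (suffix e₂))) t₀ ≐ u₀ , abs-≐ (extAbsTerm e₂ r) r′

  mutual
    abstractForm : ∀ {Γ Δ} (φ : Formula E Γ) (a : Env A Δ) →
                   Σ (Extension a) λ e → Σ (Formula S (Γ ++ Δ⁺ e)) λ φ₀ → AbsForm (a⁺ e) φ₀ φ
    abstractForm (atom θ) a with abstractAtom θ a
    ... | e , θ₀ , r = e , atom θ₀ , abs-atom r
    abstractForm ⊤ᶠ a = Extension-refl a , ⊤ᶠ , abs-⊤
    abstractForm ⊥ᶠ a = Extension-refl a , ⊥ᶠ , abs-⊥
    abstractForm (φ ∧ᶠ ψ) a with abstractForm₂ φ ψ a
    ... | e , φ₀ , ψ₀ , r , r′ = e , (φ₀ ∧ᶠ ψ₀) , abs-∧ r r′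
    abstractForm (φ ∨ᶠ ψ) a with abstractForm₂ φ ψ a
    ... | e , φ₀ , ψ₀ , r , r′ = e , (φ₀ ∨ᶠ ψ₀) , abs-∨ r r′
    abstractForm (φ ⇒ᶠ ψ) a with abstractForm₂ φ ψ a
    ... | e , φ₀ , ψ₀ , r , r′ = e , (φ₀ ⇒ᶠ ψ₀) , abs-⇒ r r′
    abstractForm (∃ᶠ τ φ) a with abstractForm φ a
    ... | e , φ₀ , r = e , ∃ᶠ τ φ₀ , abs-∃ r
    abstractForm (∀ᶠ τ φ) a with abstractForm φ a
    ... | e , φ₀ , r = e , ∀ᶠ τ φ₀ , abs-∀ r

    abstractForm₂ : ∀ {Γ Δ} (φ ψ : Formula E Γ) (a : Env A Δ) →
                    Σ (Extension a) λ e → Σ (Formula S (Γ ++ Δ⁺ e)) λ φ₀ → Σ (Formula S (Γ ++ Δ⁺ e)) λ ψ₀ →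
                    AbsForm (a⁺ e) φ₀ φ × AbsForm (a⁺ e) ψ₀ ψ
    abstractForm₂ {Γ} φ ψ a with abstractForm φ a
    ... | e₁ , φ₀ , r with abstractForm ψ (a⁺ e₁)
    ... | e₂ , ψ₀ , r′ =
      Extension-trans e₁ e₂ , renForm S (liftR⋆ Γ (weaken (suffix e₂))) φ₀ , ψ₀ , extAbsForm e₂ r , r′

  keepParams : ∀ {Γ₁ Γ₂ Δ} → (∀ {σ} → Var Γ₁ σ → Term S (Γ₂ ++ Δ) σ) → Sub S (Γ₁ ++ Δ) (Γ₂ ++ Δ)
  keepParams {Γ₁} {Γ₂} s₀ v = [ s₀ , (λ w → var (injR Γ₂ w)) ] (splitVar Γ₁ v)

  AbsSub-keepParams : ∀ {Γ₁ Γ₂ Δ} {a : Env A Δ} {s₀ : ∀ {σ} → Var Γ₁ σ → Term S (Γ₂ ++ Δ) σ} {s : Sub E Γ₁ Γ₂} →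
                      (∀ {σ} (u : Var Γ₁ σ) → AbsTerm a (s₀ u) (s u)) → AbsSub {a = a} (keepParams s₀) s
  AbsSub-keepParams {Γ₁} {Γ₂} {Δ} {a} {s₀} {s} s₀≈s = onΓ , onΔ
    where
      onΓ : ∀ {σ} (u : Var Γ₁ σ) → AbsTerm a (keepParams {Γ₁} {Γ₂} {Δ} s₀ (injL u)) (s u)
      onΓ u rewrite splitVar-injL {Γ = Γ₁} {Δ} u = s₀≈s u
      onΔ : ∀ {σ} (w : Var Δ σ) → keepParams {Γ₁} {Γ₂} s₀ (injR Γ₁ w) ≡ var (injR Γ₂ w)
      onΔ w rewrite splitVar-injR Γ₁ w = refl

  abstractSub : ∀ {Γ₁ Γ₂ Δ} (s : Sub E Γ₁ Γ₂) (a : Env A Δ) →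
                Σ (Extension a) λ e → Σ (Sub S (Γ₁ ++ Δ⁺ e) (Γ₂ ++ Δ⁺ e)) λ s₀ → AbsSub {a = a⁺ e} s₀ s
  abstractSub s a with abstractVars s a
    where
      abstractVars : ∀ {Γ₁ Γ₂ Δ} (s : Sub E Γ₁ Γ₂) (a : Env A Δ) →
                     Σ (Extension a) λ e → Σ (∀ {σ} → Var Γ₁ σ → Term S (Γ₂ ++ Δ⁺ e) σ) λ s₀ →
                     ∀ {σ} (u : Var Γ₁ σ) → AbsTerm (a⁺ e) (s₀ u) (s u)
      abstractVars {[]} s a = Extension-refl a , (λ ()) , (λ ())
      abstractVars {τ ∷ Γ₁} {Γ₂} s a with abstractVars (λ v → s (vs v)) a
      ... | e₁ , s₁ , rs₁ with abstractTerm (s vz) (a⁺ e₁)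
      ... | e₂ , t₀ , r = Extension-trans e₁ e₂ , s₀ , rs
        where
          s₀ : ∀ {σ} → Var (τ ∷ Γ₁) σ → Term S (Γ₂ ++ Δ⁺ e₂) σ
          s₀ vz     = t₀
          s₀ (vs u) = renTerm S (liftR⋆ Γ₂ (weaken (suffix e₂))) (s₁ u)
          rs : ∀ {σ} (u : Var (τ ∷ Γ₁) σ) → AbsTerm (a⁺ e₂) (s₀ u) (s u)
          rs vz     = r
          rs (vs u) = extAbsTerm e₂ (rs₁ u)
  ... | e , s₀ , rs = e , keepParams s₀ , AbsSub-keepParams rs

  mutual
    abs-trTerm-unique : ∀ {Γ Δ σ} {a : Env A Δ} {t₀ : Term S (Γ ++ Δ) σ} (t : Term S Γ σ) →
                        AbsTerm a t₀ (trTerm t) → t₀ ≡ renTerm S injL t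
    abs-trTerm-unique (var u)    (abs-var .u)     = refl
    abs-trTerm-unique (app f ts) (abs-app .f rs)  = cong (app f) (abs-trTerms-unique ts rs)

    abs-trTerms-unique : ∀ {Γ Δ σs} {a : Env A Δ} {ts₀ : Terms S (Γ ++ Δ) σs} (ts : Terms S Γ σs) →
                         AbsTerms a ts₀ (trTerms ts) → ts₀ ≡ renTerms S injL ts
    abs-trTerms-unique []       []       = refl
    abs-trTerms-unique (t ∷ ts) (r ∷ rs) = cong₂ _∷_ (abs-trTerm-unique t r) (abs-trTerms-unique ts rs)

  abs-trForm-unique : ∀ {Γ Δ} {a : Env A Δ} {φ₀ : Formula S (Γ ++ Δ)} (φ : Formula S Γ) →
                      AbsForm a φ₀ (trForm φ) → φ₀ ≡ renForm S injL φ
  abs-trForm-unique (atom (rel R ts)) (abs-atom (abs-rel .R rs)) =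
    cong (λ z → atom (rel R z)) (abs-trTerms-unique ts rs)
  abs-trForm-unique (atom (t ≐ u)) (abs-atom (abs-≐ r r′)) =
    cong₂ (λ x y → atom (x ≐ y)) (abs-trTerm-unique t r) (abs-trTerm-unique u r′)
  abs-trForm-unique ⊤ᶠ       abs-⊤        = refl
  abs-trForm-unique ⊥ᶠ       abs-⊥        = refl
  abs-trForm-unique (φ ∧ᶠ ψ) (abs-∧ r r′) = cong₂ _∧ᶠ_ (abs-trForm-unique φ r) (abs-trForm-unique ψ r′)
  abs-trForm-unique (φ ∨ᶠ ψ) (abs-∨ r r′) = cong₂ _∨ᶠ_ (abs-trForm-unique φ r) (abs-trForm-unique ψ r′)
  abs-trForm-unique (φ ⇒ᶠ ψ) (abs-⇒ r r′) = cong₂ _⇒ᶠ_ (abs-trForm-unique φ r) (abs-trForm-unique ψ r′)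
  abs-trForm-unique (∃ᶠ τ φ) (abs-∃ r)    =
    cong (∃ᶠ τ) (trans (abs-trForm-unique φ r) (SubstitutionLemmas.renForm-cong S (λ { vz → refl ; (vs v) → refl }) φ))
  abs-trForm-unique (∀ᶠ τ φ) (abs-∀ r)    =
    cong (∀ᶠ τ) (trans (abs-trForm-unique φ r) (SubstitutionLemmas.renForm-cong S (λ { vz → refl ; (vs v) → refl }) φ))

  mutual
    names-absTerm : ∀ {Δ σ} {a : Env A Δ} {t₀ : Term S Δ σ} {t : Term E [] σ} →
                    AbsTerm a t₀ t → subTerm E (names a) (trTerm t₀) ≡ t
    names-absTerm (abs-var ())
    names-absTerm (abs-const w p)  = cong const p
    names-absTerm (abs-app f rs)   = cong (app (inj₁ f)) (names-absTerms rs)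

    names-absTerms : ∀ {Δ σs} {a : Env A Δ} {ts₀ : Terms S Δ σs} {ts : Terms E [] σs} →
                     AbsTerms a ts₀ ts → subTerms E (names a) (trTerms ts₀) ≡ ts
    names-absTerms []       = refl
    names-absTerms (r ∷ rs) = cong₂ _∷_ (names-absTerm r) (names-absTerms rs)

  names-absAtom : ∀ {Δ} {a : Env A Δ} {θ₀ : Atomic S Δ} {θ : Atomic E []} →
                  AbsAtom a θ₀ θ → subAtom E (names a) (trAtom θ₀) ≡ θ
  names-absAtom (abs-rel R rs) = cong (rel R) (names-absTerms rs)
  names-absAtom (abs-≐ r r′)   = cong₂ _≐_ (names-absTerm r) (names-absTerm r′)

  module _ {Δ : Ctx S} {a : Env A Δ} where

    private
      lift : ∀ {Θ Γ τ} {r : Ren Θ (Γ ++ Δ)} {s : Sub E Θ Γ} →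
             (∀ {σ} (v : Var Θ σ) → AbsTerm a (var (r v)) (s v)) →
             ∀ {σ} (v : Var (τ ∷ Θ) σ) → AbsTerm a (var (liftR r v)) (liftS E s v)
      lift r≈s vz     = abs-var vz
      lift r≈s (vs v) = wkAbsTerm (r≈s v)

    mutual
      abs-trTerm : ∀ {Θ Γ σ} {r : Ren Θ (Γ ++ Δ)} {s : Sub E Θ Γ} →
                   (∀ {τ} (v : Var Θ τ) → AbsTerm a (var (r v)) (s v)) →
                   (t : Term S Θ σ) → AbsTerm a (renTerm S r t) (subTerm E s (trTerm t))
      abs-trTerm r≈s (var v)    = r≈s v
      abs-trTerm r≈s (app f ts) = abs-app f (abs-trTerms r≈s ts)

      abs-trTerms : ∀ {Θ Γ σs} {r : Ren Θ (Γ ++ Δ)} {s : Sub E Θ Γ} →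
                    (∀ {τ} (v : Var Θ τ) → AbsTerm a (var (r v)) (s v)) →
                    (ts : Terms S Θ σs) → AbsTerms a (renTerms S r ts) (subTerms E s (trTerms ts))
      abs-trTerms r≈s []       = []
      abs-trTerms r≈s (t ∷ ts) = abs-trTerm r≈s t ∷ abs-trTerms r≈s ts

    abs-trForm : ∀ {Θ Γ} {r : Ren Θ (Γ ++ Δ)} {s : Sub E Θ Γ} →
                 (∀ {τ} (v : Var Θ τ) → AbsTerm a (var (r v)) (s v)) →
                 (φ : Formula S Θ) → AbsForm a (renForm S r φ) (subForm E s (trForm φ))
    abs-trForm r≈s (atom (rel R ts)) = abs-atom (abs-rel R (abs-trTerms r≈s ts))
    abs-trForm r≈s (atom (t ≐ u))    = abs-atom (abs-≐ (abs-trTerm r≈s t) (abs-trTerm r≈s u))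
    abs-trForm r≈s ⊤ᶠ                = abs-⊤
    abs-trForm r≈s ⊥ᶠ                = abs-⊥
    abs-trForm r≈s (φ ∧ᶠ ψ)          = abs-∧ (abs-trForm r≈s φ) (abs-trForm r≈s ψ)
    abs-trForm r≈s (φ ∨ᶠ ψ)          = abs-∨ (abs-trForm r≈s φ) (abs-trForm r≈s ψ)
    abs-trForm r≈s (φ ⇒ᶠ ψ)          = abs-⇒ (abs-trForm r≈s φ) (abs-trForm r≈s ψ)
    abs-trForm r≈s (∃ᶠ τ φ)          = abs-∃ (abs-trForm (lift r≈s) φ)
    abs-trForm r≈s (∀ᶠ τ φ)          = abs-∀ (abs-trForm (lift r≈s) φ)

    plugSub-abs : (Γ : Ctx S) {σ : Sort S} (v : Var (Γ ++ Δ) σ) → AbsTerm a (var v) (plugSub Γ a v)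
    plugSub-abs []      v      = abs-const v refl
    plugSub-abs (τ ∷ Γ) vz     = abs-var vz
    plugSub-abs (τ ∷ Γ) (vs v) = Eq.subst (AbsTerm a (var (vs v))) (plugSub-vs v) (wkAbsTerm (plugSub-abs Γ v))
      where
        plugSub-vs : ∀ {σ} (v : Var (Γ ++ Δ) σ) → renTerm E vs (plugSub Γ a v) ≡ plugSub (τ ∷ Γ) a (vs v)
        plugSub-vs v with splitVar Γ v
        ... | inj₁ _ = refl
        ... | inj₂ _ = refl

    abs-plug : (Γ : Ctx S) (φ : Formula S (Γ ++ Δ)) → AbsForm a φ (plug Γ φ a)
    abs-plug Γ φ = Eq.subst (λ φ₀ → AbsForm a φ₀ (plug Γ φ a))
                            (SubstitutionLemmas.renForm-id S (λ _ → refl) φ) (abs-trForm (plugSub-abs Γ) φ)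

    abs-injL : ∀ {Γ} (ψ : Formula S Γ) → AbsForm a (renForm S injL ψ) (trForm ψ)
    abs-injL ψ = Eq.subst (AbsForm a (renForm S injL ψ))
                          (SubstitutionLemmas.subForm-id E (λ _ → refl) (trForm ψ)) (abs-trForm abs-var ψ)

module Conservativity (S : Signature) (A : Structure S) (T : Theory S) where
  open SubstitutionLemmas S
  open DerivedRules S T
  open Abstraction S A
  private
    module DiagRules = DerivedRules E (Diag A)

  Guarded : (Γ : Ctx S) {Δ : Ctx S} (a : Env A Δ) → Formula S (Γ ++ Δ) → Formula S (Γ ++ Δ) → Set
  Guarded Γ {Δ} a φ ψ = Σ (Formula S Δ) λ χ →
    IsRegular S χ × Der E (Diag A) [] ⊤ᶠ (instantiate χ a) × Der S T (Γ ++ Δ) (renForm S (injR Γ) χ ∧ᶠ φ) ψ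

  module _ {Γ Δ : Ctx S} {a : Env A Δ} where

    guarded : ∀ {φ ψ} → Der S T (Γ ++ Δ) φ ψ → Guarded Γ a φ ψ
    guarded d = ⊤ᶠ , reg-⊤ , ⊤-intro , (∧-elim₂ ⨾ d)

    Guarded-map : ∀ {φ₁ ψ₁ φ ψ} →
                  (∀ {χ} → Der S T (Γ ++ Δ) (χ ∧ᶠ φ₁) ψ₁ → Der S T (Γ ++ Δ) (χ ∧ᶠ φ) ψ) →
                  Guarded Γ a φ₁ ψ₁ → Guarded Γ a φ ψ
    Guarded-map f (χ , reg , holds , d) = χ , reg , holds , f d

    Guarded-map₂ : ∀ {φ₁ ψ₁ φ₂ ψ₂ φ ψ} →
                   (∀ {χ} → Der S T (Γ ++ Δ) (χ ∧ᶠ φ₁) ψ₁ → Der S T (Γ ++ Δ) (χ ∧ᶠ φ₂) ψ₂ →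
                            Der S T (Γ ++ Δ) (χ ∧ᶠ φ) ψ) →
                   Guarded Γ a φ₁ ψ₁ → Guarded Γ a φ₂ ψ₂ → Guarded Γ a φ ψ
    Guarded-map₂ f (χ₁ , reg₁ , holds₁ , d₁) (χ₂ , reg₂ , holds₂ , d₂) =
      (χ₁ ∧ᶠ χ₂) , reg-∧ reg₁ reg₂ , ∧-intro holds₁ holds₂ ,
      f (∧-intro (∧-elim₁ ⨾ ∧-elim₁) ∧-elim₂ ⨾ d₁) (∧-intro (∧-elim₁ ⨾ ∧-elim₂) ∧-elim₂ ⨾ d₂)

    Guarded-trans : ∀ {φ ψ ρ} → Guarded Γ a φ ψ → Guarded Γ a ψ ρ → Guarded Γ a φ ρ
    Guarded-trans = Guarded-map₂ (λ d₁ d₂ → ∧-intro ∧-elim₁ d₁ ⨾ d₂)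

    Guarded-∧ : ∀ {φ ψ ρ} → Guarded Γ a φ ψ → Guarded Γ a φ ρ → Guarded Γ a φ (ψ ∧ᶠ ρ)
    Guarded-∧ = Guarded-map₂ ∧-intro

    Guarded-cut : ∀ {φ ψ ρ} → Guarded Γ a φ ψ → Der S T (Γ ++ Δ) (ψ ∧ᶠ φ) ρ → Guarded Γ a φ ρ
    Guarded-cut g d = Guarded-trans (Guarded-∧ g (guarded ident)) (guarded d)

  Guarded-under : ∀ {Γ Δ τ} {a : Env A Δ} {φ₁ ψ₁ φ ψ} →
                  (∀ {χ} → Der S T (τ ∷ Γ ++ Δ) (renForm S vs χ ∧ᶠ φ₁) ψ₁ → Der S T (Γ ++ Δ) (χ ∧ᶠ φ) ψ) →
                  Guarded (τ ∷ Γ) a φ₁ ψ₁ → Guarded Γ a φ ψ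
  Guarded-under f (χ , reg , holds , d) =
    χ , reg , holds , f (cast (cong (_∧ᶠ _) (sym (renForm-∘ (λ _ → refl) χ))) refl d)

  Guarded-cast : ∀ {Γ Δ} {a : Env A Δ} {φ φ′ ψ ψ′} → φ ≡ φ′ → ψ ≡ ψ′ → Guarded Γ a φ ψ → Guarded Γ a φ′ ψ′
  Guarded-cast refl refl g = g

  mutual
    absTerm-unique : ∀ {Γ Δ σ} {a : Env A Δ} {φ} {t₀ t₁ : Term S (Γ ++ Δ) σ} {t : Term E Γ σ} →
                     AbsTerm a t₀ t → AbsTerm a t₁ t → Guarded Γ a φ (atom (t₀ ≐ t₁))
    absTerm-unique (abs-var u) (abs-var .u) = guarded (≐-refl _)
    absTerm-unique {a = a} (abs-const w p) (abs-const w′ q) =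
      atom (var w ≐ var w′) , reg-atom _ , axiom (_ , (var w ≐ var w′) , a , trans p (sym q)) , ∧-elim₁
    absTerm-unique (abs-app f rs) (abs-app .f rs′) = Guarded-cut (absTerms-unique rs rs′) (∧-elim₁ ⨾ app-cong f _ _)

    absTerms-unique : ∀ {Γ Δ σs} {a : Env A Δ} {φ} {ts₀ ts₁ : Terms S (Γ ++ Δ) σs} {ts : Terms E Γ σs} →
                      AbsTerms a ts₀ ts → AbsTerms a ts₁ ts → Guarded Γ a φ (ts₀ ≐⋆ ts₁)
    absTerms-unique []       []         = guarded ⊤-intro
    absTerms-unique (r ∷ rs) (r′ ∷ rs′) = Guarded-∧ (absTerm-unique r r′) (absTerms-unique rs rs′)

  abs-unique : ∀ {Γ Δ} {a : Env A Δ} {φ₀ φ₁ : Formula S (Γ ++ Δ)} {φ : Formula E Γ} →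
               AbsForm a φ₀ φ → AbsForm a φ₁ φ → Guarded Γ a φ₀ φ₁
  abs-unique (abs-atom (abs-rel R rs)) (abs-atom (abs-rel .R rs′)) =
    Guarded-cut (absTerms-unique rs rs′) (rel-cong R _ _)
  abs-unique (abs-atom (abs-≐ r₁ r₂)) (abs-atom (abs-≐ r₁′ r₂′)) =
    Guarded-cut (Guarded-∧ (absTerm-unique r₁ r₁′) (Guarded-∧ (absTerm-unique r₂ r₂′) (guarded ⊤-intro)))
                (≐-cong _ _ _ _)
  abs-unique abs-⊤ abs-⊤ = guarded ident
  abs-unique abs-⊥ abs-⊥ = guarded ident
  abs-unique (abs-∧ r₁ r₂) (abs-∧ r₁′ r₂′) = Guarded-map₂
    (λ d₁ d₂ → ∧-intro (∧-intro ∧-elim₁ (∧-elim₂ ⨾ ∧-elim₁) ⨾ d₁) (∧-intro ∧-elim₁ (∧-elim₂ ⨾ ∧-elim₂) ⨾ d₂))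
    (abs-unique r₁ r₁′) (abs-unique r₂ r₂′)
  abs-unique (abs-∨ r₁ r₂) (abs-∨ r₁′ r₂′) = Guarded-map₂
    (λ d₁ d₂ → ⇒-elim (∨-elim (⇒-intro (d₁ ⨾ ∨-intro₁)) (⇒-intro (d₂ ⨾ ∨-intro₂))))
    (abs-unique r₁ r₁′) (abs-unique r₂ r₂′)
  abs-unique (abs-⇒ r₁ r₂) (abs-⇒ r₁′ r₂′) = Guarded-map₂
    (λ d₁ d₂ → ⇒-intro (∧-intro (∧-elim₂ ⨾ ∧-elim₁)
                                (∧-intro (∧-intro (∧-elim₂ ⨾ ∧-elim₁) ∧-elim₁ ⨾ d₁) (∧-elim₂ ⨾ ∧-elim₂) ⨾ ⇒-elim ident)
                        ⨾ d₂))
    (abs-unique r₁′ r₁) (abs-unique r₂ r₂′)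
  abs-unique (abs-∃ r) (abs-∃ r′) = Guarded-under (λ d → ∧∃-left (d ⨾ ∃-left⁻ ident)) (abs-unique r r′)
  abs-unique (abs-∀ r) (abs-∀ r′) = Guarded-under ∀-mono (abs-unique r r′)

  Guarded-over : ∀ {Γ Δ τ} {a : Env A Δ} {φ ψ φ₁ ψ₁} →
                 (∀ {χ} → Der S T (Γ ++ Δ) (χ ∧ᶠ φ) ψ → Der S T (τ ∷ Γ ++ Δ) (renForm S vs χ ∧ᶠ φ₁) ψ₁) →
                 Guarded Γ a φ ψ → Guarded (τ ∷ Γ) a φ₁ ψ₁
  Guarded-over f (χ , reg , holds , d) =
    χ , reg , holds , cast (cong (_∧ᶠ _) (renForm-∘ (λ _ → refl) χ)) refl (f d)

  Guarded-subst : ∀ {Γ₁ Γ₂ Δ} {a : Env A Δ} (s : Sub S (Γ₁ ++ Δ) (Γ₂ ++ Δ)) →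
                  (∀ {σ} (w : Var Δ σ) → s (injR Γ₁ w) ≡ var (injR Γ₂ w)) →
                  ∀ {φ ψ} → Guarded Γ₁ a φ ψ → Guarded Γ₂ a (subForm S s φ) (subForm S s ψ)
  Guarded-subst {Γ₁} {Γ₂} s s-params (χ , reg , holds , d) =
    χ , reg , holds , cast (cong (_∧ᶠ _) guard) refl (subst s d)
    where
      guard : subForm S s (renForm S (injR Γ₁) χ) ≡ renForm S (injR Γ₂) χ
      guard = trans (subForm-renForm (λ w → sym (s-params w)) χ) (sym (renForm-subForm (λ _ → refl) χ))

  -- The newest parameter is bound existentially in the guard; its value in A
  -- witnesses the guard in Diag(A).
  Guarded-discharge : ∀ {Γ Δ τ} {a⁺ : Env A (τ ∷ Δ)} {φ ψ : Formula S (Γ ++ Δ)} →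
                      Guarded Γ a⁺ (renForm S (liftR⋆ Γ vs) φ) (renForm S (liftR⋆ Γ vs) ψ) →
                      Guarded Γ (λ w → a⁺ (vs w)) φ ψ
  Guarded-discharge {Γ} {Δ} {τ} {a⁺} {φ} {ψ} (χ , reg , holds , d) =
    ∃ᶠ τ χ , reg-∃ reg , DiagRules.∃-intro (const (a⁺ vz)) (DiagRules.cast refl instance≡ holds) , ∃∧-left hoisted
    where
      instance≡ : instantiate χ a⁺ ≡
                  subForm E (DiagRules.single (const (a⁺ vz))) (subForm E (liftS E (names (λ w → a⁺ (vs w)))) (trForm χ))
      instance≡ = sym (SubstitutionLemmas.subForm-∘ E (λ { vz → refl ; (vs v) → refl }) (trForm χ))
      hoisted : Der S T (τ ∷ Γ ++ Δ) (renForm S (liftR (injR Γ)) χ ∧ᶠ renForm S vs φ) (renForm S vs ψ)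
      hoisted = cast (cong₂ _∧ᶠ_ (renForm-∘ (λ w → sym (hoist-injR Γ w)) χ)
                                 (renForm-∘ (λ v → sym (hoist-liftR⋆ Γ v)) φ))
                     (renForm-∘ (λ v → sym (hoist-liftR⋆ Γ v)) ψ)
                     (rename (hoist Γ) d)

  Guarded-strengthen : ∀ {Γ Δ Δ⁺} (p : Suffix Δ Δ⁺) {a : Env A Δ} {a⁺ : Env A Δ⁺} →
                       (∀ {σ} (v : Var Δ σ) → a⁺ (weaken p v) ≡ a v) → ∀ {φ ψ} →
                       Guarded Γ a⁺ (renForm S (liftR⋆ Γ (weaken p)) φ) (renForm S (liftR⋆ Γ (weaken p)) ψ) →
                       Guarded Γ a φ ψ
  Guarded-strengthen {Γ} here a⁺≗a {φ} {ψ} (χ , reg , holds , d) =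
    χ , reg , DiagRules.cast refl (SubstitutionLemmas.subForm-cong E (λ v → cong const (a⁺≗a v)) (trForm χ)) holds ,
    cast (cong (_ ∧ᶠ_) (renForm-id (liftR⋆-id Γ) φ)) (renForm-id (liftR⋆-id Γ) ψ) d
  Guarded-strengthen {Γ} (there p) a⁺≗a {φ} {ψ} g =
    Guarded-strengthen p a⁺≗a (Guarded-discharge (Guarded-cast (sym (renForm-∘ (liftR⋆-∘ Γ (weaken p) vs) φ))
                                                               (sym (renForm-∘ (liftR⋆-∘ Γ (weaken p) vs) ψ)) g))

  Guarded-restrict : ∀ {Γ Δ} {a : Env A Δ} (e : Extension a) {φ ψ} →
                     Guarded Γ (a⁺ e) (renForm S (liftR⋆ Γ (weaken (suffix e))) φ)
                                      (renForm S (liftR⋆ Γ (weaken (suffix e))) ψ) →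
                     Guarded Γ a φ ψ
  Guarded-restrict e = Guarded-strengthen (suffix e) (a⁺-weaken e)

  -- The rules whose premises mention formulas absent from the conclusion (cut,
  -- substitution, the equality rule and the inverted quantifier rules) abstract
  -- those formulas with fresh parameters, which Guarded-restrict then binds.
  Reflects : (Γ : Ctx S) → Formula E Γ → Formula E Γ → Set
  Reflects Γ φ ψ = ∀ {Δ} (a : Env A Δ) {φ₀ ψ₀} → AbsForm a φ₀ φ → AbsForm a ψ₀ ψ → Guarded Γ a φ₀ ψ₀

  reflects-cut : ∀ {Γ φ ψ ρ} → Reflects Γ φ ψ → Reflects Γ ψ ρ → Reflects Γ φ ρ
  reflects-cut {ψ = ψ} φ⊢ψ ψ⊢ρ a rφ rρ with abstractForm ψ a
  ... | e , ψ₀ , rψ =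
    Guarded-restrict e (Guarded-trans (φ⊢ψ (a⁺ e) (extAbsForm e rφ) rψ) (ψ⊢ρ (a⁺ e) rψ (extAbsForm e rρ)))

  reflects-subst : ∀ {Γ₁ Γ₂ φ ψ} (s : Sub E Γ₁ Γ₂) → Reflects Γ₁ φ ψ → Reflects Γ₂ (subForm E s φ) (subForm E s ψ)
  reflects-subst {Γ₁} {φ = φ} {ψ} s φ⊢ψ a rsφ rsψ with abstractForm₂ φ ψ a
  ... | e₁ , φ₀ , ψ₀ , rφ , rψ with abstractSub s (a⁺ e₁)
  ... | e₂ , s₀ , s₀≈s@(_ , s₀-params) =
    Guarded-restrict e₁ (Guarded-restrict e₂
      (Guarded-trans (abs-unique (extAbsForm e₂ (extAbsForm e₁ rsφ)) (subAbsForm s₀≈s rφ′))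
      (Guarded-trans (Guarded-subst s₀ s₀-params (φ⊢ψ (a⁺ e₂) rφ′ rψ′))
                     (abs-unique (subAbsForm s₀≈s rψ′) (extAbsForm e₂ (extAbsForm e₁ rsψ))))))
    where
      rφ′ : AbsForm (a⁺ e₂) (renForm S (liftR⋆ Γ₁ (weaken (suffix e₂))) φ₀) φ
      rφ′ = extAbsForm e₂ rφ
      rψ′ : AbsForm (a⁺ e₂) (renForm S (liftR⋆ Γ₁ (weaken (suffix e₂))) ψ₀) ψ
      rψ′ = extAbsForm e₂ rψ

  reflects-eq-subst : ∀ {Γ τ} (φ : Formula E (τ ∷ Γ)) →
                      Reflects (τ ∷ τ ∷ Γ) (atom (var (vs vz) ≐ var vz) ∧ᶠ renForm E (eqR₀ E) φ) (renForm E (eqR₁ E) φ)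
  reflects-eq-subst φ a (abs-∧ (abs-atom (abs-≐ (abs-var _) (abs-var _))) rφ₀) rφ₁ with abstractForm φ a
  ... | e , φ₀ , rφ =
    Guarded-restrict e
      (Guarded-trans (Guarded-∧ (guarded ∧-elim₁)
                                (Guarded-trans (guarded ∧-elim₂) (abs-unique (extAbsForm e rφ₀) rφ-eqR₀)))
      (Guarded-trans (guarded (eq-subst φ₀)) (abs-unique rφ-eqR₁ (extAbsForm e rφ₁))))
    where
      rφ-eqR₀ : AbsForm (a⁺ e) (renForm S (eqR₀ S) φ₀) (renForm E (eqR₀ E) φ)
      rφ-eqR₀ = renFreeAbsForm ((λ { vz → refl ; (vs u) → refl }) , (λ _ → refl)) rφ
      rφ-eqR₁ : AbsForm (a⁺ e) (renForm S (eqR₁ S) φ₀) (renForm E (eqR₁ E) φ)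
      rφ-eqR₁ = renFreeAbsForm ((λ { vz → refl ; (vs u) → refl }) , (λ _ → refl)) rφ

  reflects-∃-left⁻ : ∀ {Γ τ φ ψ} → Reflects Γ (∃ᶠ τ φ) ψ → Reflects (τ ∷ Γ) φ (renForm E vs ψ)
  reflects-∃-left⁻ {ψ = ψ} ∃φ⊢ψ a rφ rψ with abstractForm ψ a
  ... | e , ψ₀ , r =
    Guarded-restrict e (Guarded-trans (Guarded-over ∧∃-left⁻ (∃φ⊢ψ (a⁺ e) (abs-∃ (extAbsForm e rφ)) r))
                                      (abs-unique (wkAbsForm r) (extAbsForm e rψ)))

  reflects-∀-right⁻ : ∀ {Γ τ φ ψ} → Reflects Γ φ (∀ᶠ τ ψ) → Reflects (τ ∷ Γ) (renForm E vs φ) ψ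
  reflects-∀-right⁻ {φ = φ} φ⊢∀ψ a rφ rψ with abstractForm φ a
  ... | e , φ₀ , r =
    Guarded-restrict e (Guarded-trans (abs-unique (extAbsForm e rφ) (wkAbsForm r))
                                      (Guarded-over ∀-right⁻ (φ⊢∀ψ (a⁺ e) r (abs-∀ (extAbsForm e rψ)))))

  reflect : ∀ {Γ φ ψ} → Der E (trTheory T ∪ Diag A) Γ φ ψ → Reflects Γ φ ψ
  reflect (axiom (inj₁ i)) a rφ rψ =
    guarded (cast (sym (abs-trForm-unique (pre T i) rφ)) (sym (abs-trForm-unique (post T i) rψ)) (rename injL (axiom i)))
  reflect (axiom (inj₂ i)) a abs-⊤ (abs-atom {θ₀ = θ₀} rθ) =
    atom θ₀ , reg-atom θ₀ , DiagRules.cast refl (cong atom (sym (names-absAtom rθ))) (axiom i) ,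
    cast (cong (_∧ᶠ ⊤ᶠ) (sym (renForm-id (λ _ → refl) (atom θ₀)))) refl ∧-elim₁
  reflect ident                a rφ rψ = abs-unique rφ rψ
  reflect (subst s d)          a rφ rψ = reflects-subst s (reflect d) a rφ rψ
  reflect (cut d₁ d₂)          a rφ rψ = reflects-cut (reflect d₁) (reflect d₂) a rφ rψ
  reflect eq-refl a abs-⊤ (abs-atom (abs-≐ (abs-var _) (abs-var _))) = guarded eq-refl
  reflect (eq-subst φ)         a rφ rψ = reflects-eq-subst φ a rφ rψ
  reflect ⊤-intro              a rφ abs-⊤ = guarded ⊤-intro
  reflect ∧-elim₁              a (abs-∧ rφ _) rψ = Guarded-trans (guarded ∧-elim₁) (abs-unique rφ rψ)
  reflect ∧-elim₂              a (abs-∧ _ rφ) rψ = Guarded-trans (guarded ∧-elim₂) (abs-unique rφ rψ)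
  reflect (∧-intro d₁ d₂)      a rφ (abs-∧ rψ rρ) = Guarded-∧ (reflect d₁ a rφ rψ) (reflect d₂ a rφ rρ)
  reflect ⊥-elim               a abs-⊥ rψ = guarded ⊥-elim
  reflect ∨-intro₁             a rφ (abs-∨ rψ _) = Guarded-trans (abs-unique rφ rψ) (guarded ∨-intro₁)
  reflect ∨-intro₂             a rφ (abs-∨ _ rψ) = Guarded-trans (abs-unique rφ rψ) (guarded ∨-intro₂)
  reflect (∨-elim d₁ d₂)       a (abs-∨ rφ rψ) rρ =
    Guarded-map₂ (λ d₁ d₂ → ⇒-elim (∨-elim (⇒-intro d₁) (⇒-intro d₂)))
                 (reflect d₁ a rφ rρ) (reflect d₂ a rψ rρ)
  reflect (⇒-intro d)          a rψ (abs-⇒ rφ rρ) =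
    Guarded-map (λ d → ⇒-intro (∧-intro (∧-elim₂ ⨾ ∧-elim₁) (∧-intro ∧-elim₁ (∧-elim₂ ⨾ ∧-elim₂)) ⨾ d))
                (reflect d a (abs-∧ rφ rψ) rρ)
  reflect (⇒-elim d)           a (abs-∧ rφ rψ) rρ =
    Guarded-map (λ d → ∧-intro (∧-elim₂ ⨾ ∧-elim₁) (∧-intro ∧-elim₁ (∧-elim₂ ⨾ ∧-elim₂)) ⨾ ⇒-elim d)
                (reflect d a rψ (abs-⇒ rφ rρ))
  reflect (∃-left d)           a (abs-∃ rφ) rψ = Guarded-under ∧∃-left (reflect d a rφ (wkAbsForm rψ))
  reflect (∃-left⁻ d)          a rφ rψ = reflects-∃-left⁻ (reflect d) a rφ rψ
  reflect (∀-right d)          a rφ (abs-∀ rψ) = Guarded-under ∀-right (reflect d a (wkAbsForm rφ) rψ)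
  reflect (∀-right⁻ d)         a rφ rψ = reflects-∀-right⁻ (reflect d) a rφ rψ

lemma3p4 : (S : Signature) (A : Structure S) (T : Theory S)
           (Γ Δ : List (Sort S))
           (ψ : Formula S Γ) (φ : Formula S (Γ ++ Δ)) (a : Env A Δ) →
           Der (extend S A) (trTheory T ∪ Diag A) Γ (plug Γ φ a) (trForm ψ) →
           Σ (Formula S Δ) (λ χ →
             IsRegular S χ
             × Der (extend S A) (Diag A) [] (⊤ᶠ) (instantiate χ a)
             × Der S T (Γ ++ Δ) (renForm S (injR Γ) χ ∧ᶠ φ) (renForm S injL ψ))
lemma3p4 S A T Γ Δ ψ φ a d = reflect d a (abs-plug Γ φ) (abs-injL ψ)
  where
    open Abstraction S A
    open Conservativity S A T
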